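{- Let $q$ be a prime power, $d\geq 1$, and let $\omega$ and $\omega'$ be generators of the multiplicative group $F_q^*$. Then the Hamming maps $\mathcal H(d,\omega)$ and $\mathcal H(d,\omega')$ are isomorphic if and only if $\omega$ and $\omega'$ are conjugate under the Galois group of $F_q$ (i.e. $\omega'=\omega^{p^k}$ for some $k$, where $p$ is the characteristic).
   Context: Let $F_q$ be the field with $q$ elements, $n=d(q-1)$, $V=F_q^d$ (row vectors) with standard basis $e_1,\dots,e_d$. For a generator $\omega$ of $F_q^*$ let $M_\omega$ be the $d\times d$ matrix with entries $m_{i,i+1}=1$ for $1\le i\le d-1$, $m_{d,1}=\omega$, and all other entries $0$. The Hamming map $\mathcal H(d,\omega)$ is the Cayley map (on a compact oriented surface) of the additive group $V$ with respect to the generating set $S=\{\lambda e_i:\lambda\in F_q^*,1\le i\le d\}$, in which the rotation at every vertex $v$ sends the neighbour $v+e_1M_\omega^{i}$ to $v+e_1M_\omega^{i+1}$ (indices mod $n$); i.e. the cyclic order of neighbours of $v$ is $v+e_1,\dots,v+e_d,v+\omega e_1,\dots,v+\omega^{q-2}e_d$. Maps are isomorphic if there is an orientation-preserving isomorphism between them. -}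

module Defs where

open import Level using (0ℓ)
open import Data.Nat as ℕ using (ℕ; zero; suc; _%_)
open import Data.Nat.DivMod using (m%n<n)
open import Data.Fin as Fin using (Fin; toℕ; fromℕ<)
open import Data.Vec as Vec using (Vec; tabulate; lookup; zipWith; foldr)
open import Data.Product using (Σ; ∃; _×_; _,_; proj₁; proj₂)
open import Data.Bool using (if_then_else_)
open import Relation.Nullary using (¬_)
open import Relation.Nullary.Decidable using (⌊_⌋)
open import Relation.Binary.PropositionalEquality using (_≡_)
open import Function.Bundles using (_↔_; Inverse)
open import Algebra.Structures using (IsCommutativeRing)

record FiniteField (q : ℕ) : Set₁ where
  infixl 6 _+_
  infixl 7 _*_
  field
    F     : Set
    _+_   : F → F → F
    _*_   : F → F → F
    -_    : F → F
    0#    : F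
    1#    : F
    isCommutativeRing : IsCommutativeRing (_≡_ {A = F}) _+_ _*_ -_ 0# 1#
    0≢1   : ¬ (0# ≡ 1#)
    inverse : ∀ x → ¬ (x ≡ 0#) → ∃ λ y → x * y ≡ 1#
    enum  : Fin q ↔ F

  pow : F → ℕ → F
  pow x zero    = 1#
  pow x (suc k) = x * pow x k

  IsGenerator : F → Set
  IsGenerator ω = ¬ (ω ≡ 0#) × (∀ x → ¬ (x ≡ 0#) → ∃ λ i → pow ω i ≡ x)

module Hamming {q : ℕ} (𝔽 : FiniteField q) (d : ℕ) where
  open FiniteField 𝔽

  V : Set
  V = Vec F d

  _⊕_ : V → V → V
  _⊕_ = zipWith _+_

  n : ℕ
  n = d ℕ.* (q ℕ.∸ 1)

  e₁ : V
  e₁ = tabulate (λ k → if ⌊ toℕ k ℕ.≟ 0 ⌋ then 1# else 0#)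

  -- The matrix M_ω: m_{i,i+1} = 1 (1 ≤ i ≤ d-1), m_{d,1} = ω, others 0
  -- (indices here are 0-based: entry (i,j)).
  M : F → Fin d → Fin d → F
  M ω i j =
    if ⌊ toℕ j ℕ.≟ suc (toℕ i) ⌋ then 1#
    else (if ⌊ toℕ i ℕ.≟ d ℕ.∸ 1 ⌋ then (if ⌊ toℕ j ℕ.≟ 0 ⌋ then ω else 0#) else 0#)

  _·_ : V → (Fin d → Fin d → F) → V
  x · A = tabulate (λ j → foldr (λ _ → F) _+_ 0# (tabulate (λ i → lookup x i * A i j)))

  _·M[_]^_ : V → F → ℕ → V
  x ·M[ ω ]^ zero  = x
  x ·M[ ω ]^ suc k = (x ·M[ ω ]^ k) · M ω

  gen : F → Fin n → V
  gen ω j = e₁ ·M[ ω ]^ toℕ j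

  next : ∀ {m} → Fin m → Fin m
  next {suc m} j = fromℕ< (m%n<n (suc (toℕ j)) (suc m))

  -- Darts (arcs) of the Hamming map H(d, ω): the dart (v , j) is the arc
  -- from v to v + s_j.  Its tail is v and its head is v + s_j.
  Dart : Set
  Dart = V × Fin n

  tail : Dart → V
  tail (v , j) = v

  head : F → Dart → V
  head ω (v , j) = v ⊕ gen ω j

  R : Dart → Dart
  R (v , j) = (v , next j)

  -- The dart-reversing involution L of H(d,ω) sends an arc u→w to the
  -- arc w→u.  An orientation-preserving isomorphism H(d,ω) → H(d,ω') is a
  -- bijection φ of darts with φ ∘ R = R ∘ φ and φ ∘ L = L' ∘ φ; since the
  -- Cayley graph is simple, the latter is expressed as: φ maps each pair
  -- of mutually reverse arcs to a pair of mutually reverse arcs.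
  record Iso (ω ω' : F) : Set where
    field
      φ     : Dart ↔ Dart
    private
      f = Inverse.to φ
    field
      comm-R : ∀ x → f (R x) ≡ R (f x)
      comm-L : ∀ x y → tail y ≡ head ω x → head ω y ≡ tail x →
               (tail (f y) ≡ head ω' (f x)) × (head ω' (f y) ≡ tail (f x))

HammingIsomorphic : ∀ {q} (𝔽 : FiniteField q) (d : ℕ) (ω ω' : FiniteField.F 𝔽) → Set
HammingIsomorphic 𝔽 d ω ω' = Hamming.Iso 𝔽 d ω ω'

-- (⇐) x ↦ x^(p^k) is a field automorphism; applied coordinatewise to V it sends e₁ M_ω^j to
-- e₁ M_{ω^(p^k)}^j, so together with the identity on dart indices it is an isomorphism.
-- (⇒) An isomorphism f commutes with the rotation, so f (v , j) = (σ v , c v + j). Since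
-- e₁ M_ω^(j + d h) = - e₁ M_ω^j where ω^h = ω'^h = -1, compatibility with dart reversal gives
-- σ (v + e₁ M_ω^j) = σ v + e₁ M_ω'^(c v + j), and e₁ M_ω'^(c v + m) does not depend on v.
-- So one coordinate of x ↦ σ (x e₁) - σ 0 is an additive map g with g (ω^b) = ω'^b g 1,
-- i.e. g x = g 1 · x^t where ω' = ω^t, and g 1 ≠ 0: x ↦ x^t is additive, with t < q - 1.
-- Dividing t by p (the Frobenius map is injective) reduces to p ∤ t, and then t ≥ 2 is
-- impossible: ∑_{x ≠ 0} x⁻¹ (x + 1)^t is -t by the binomial theorem and power sums, but 0
-- by additivity. Hence t is a power of p.

module Submission where

open import Defs
open import Data.Nat using (ℕ; _≤_; _^_)
open import Data.Nat.Primality using (Prime)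
open import Data.Product using (∃)
open import Relation.Binary.PropositionalEquality using (_≡_)
open import Function.Bundles using (_⇔_)

open import Level using (0ℓ)
open import Data.Nat as ℕ using (zero; suc; _∸_; _<_; z≤n; s≤s; NonZero)
import Data.Nat.Properties as ℕ
open import Data.Nat.Divisibility using (_∣_; _∤_; divides; _∣?_; ∣⇒≤; ∣1⇒≡1; m∣m*n)
open import Data.Nat.Primality using (euclidsLemma; prime⇒nonTrivial; prime⇒nonZero; prime⇒irreducible)
open import Data.Nat.Coprimality using (Coprime; coprime-Bézout)
open import Data.Nat.GCD using (module Bézout)
open import Data.Nat.Combinatorics using (_C_; nCk≡n!/k![n-k]!; k![n∸k]!∣n!; nCn≡1; nC1≡n; nCk≡nC[n∸k])
open import Data.Nat.DivMod using (_%_; _/_; m%n<n; m≡m%n+[m/n]*n; m*[n/m]≡n; m<n⇒m%n≡m)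
open import Data.Nat.Tactic.RingSolver using (solve-∀)
open import Data.Nat.Induction using (<-rec)
open import Data.Fin as Fin using (Fin; toℕ; fromℕ; fromℕ<; punchOut)
import Data.Fin.Properties as Fin
open import Data.Fin.Permutation using (Permutation; permutation)
open import Data.Product using (_×_; _,_; proj₁; proj₂)
open import Data.Sum using (_⊎_; inj₁; inj₂)
open import Relation.Nullary using (¬_; Dec; yes; no; contradiction)
open import Relation.Binary.PropositionalEquality using (refl; sym; trans; cong; cong₂; subst; _≢_; module ≡-Reasoning)
open import Function using (_∘_)
open import Function.Bundles using (Inverse; mk↔ₛ′; mk⇔)
open import Data.Vec.Functional using (removeAt)
open import Data.Vec as Vec using (lookup; tabulate)
import Data.Vec.Properties as Vec
open import Data.Vec.Relation.Binary.Pointwise.Extensional using (ext; Pointwise-≡⇒≡)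
open import Data.Bool using (true; false; if_then_else_)
open import Data.Bool.Properties using (if-float; if-cong₂)
open import Relation.Nullary.Decidable using (⌊_⌋; isYes≗does; dec-true; dec-false)
open import Algebra.Bundles using (CommutativeRing; Semiring)
import Algebra.Properties.CommutativeSemiring.Binomial as BinomialTheorem
open import Data.Fin.Patterns using (0F)

⌊⌋-yes : ∀ {A : Set} (a? : Dec A) → A → ⌊ a? ⌋ ≡ true
⌊⌋-yes a? a = trans (isYes≗does a?) (dec-true a? a)

⌊⌋-no : ∀ {A : Set} (a? : Dec A) → ¬ A → ⌊ a? ⌋ ≡ false
⌊⌋-no a? ¬a = trans (isYes≗does a?) (dec-false a? ¬a)

prime>1 : ∀ {p} → Prime p → 1 < p
prime>1 {p} p-prime = ℕ.nonTrivial⇒n>1 p {{prime⇒nonTrivial p-prime}}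

prime∣n!⇒p≤n : ∀ {p} → Prime p → ∀ n → p ∣ n ℕ.! → p ≤ n
prime∣n!⇒p≤n p-prime zero    p∣1  = contradiction (∣1⇒≡1 p∣1) (ℕ.>⇒≢ (prime>1 p-prime))
prime∣n!⇒p≤n p-prime (suc n) p∣n! with euclidsLemma (suc n) (n ℕ.!) p-prime p∣n!
... | inj₁ p∣1+n = ∣⇒≤ p∣1+n
... | inj₂ p∣n!′ = ℕ.m≤n⇒m≤1+n (prime∣n!⇒p≤n p-prime n p∣n!′)

prime∣pCk : ∀ {p k} → Prime p → 0 < k → k < p → p ∣ p C k
prime∣pCk {zero}      p-prime = contradiction refl (ℕ.≢-nonZero⁻¹ 0 {{prime⇒nonZero p-prime}})
prime∣pCk {p@(suc p′)} {k} p-prime 0<k k<p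
  with euclidsLemma (k ℕ.! ℕ.* (p ∸ k) ℕ.!) (p C k) p-prime p∣k![p∸k]!*pCk
  where
  k≤p = ℕ.<⇒≤ k<p
  instance _ = ℕ._!*_!≢0 k (p ∸ k)
  p∣k![p∸k]!*pCk : p ∣ (k ℕ.! ℕ.* (p ∸ k) ℕ.!) ℕ.* (p C k)
  p∣k![p∸k]!*pCk = subst (p ∣_)
    (sym (trans (cong ((k ℕ.! ℕ.* (p ∸ k) ℕ.!) ℕ.*_) (nCk≡n!/k![n-k]! k≤p)) (m*[n/m]≡n (k![n∸k]!∣n! k≤p))))
    (m∣m*n (p′ ℕ.!))
... | inj₂ p∣pCk = p∣pCk
... | inj₁ p∣k![p∸k]! with euclidsLemma (k ℕ.!) ((p ∸ k) ℕ.!) p-prime p∣k![p∸k]!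
...   | inj₁ p∣k!     = contradiction (prime∣n!⇒p≤n p-prime k p∣k!) (ℕ.<⇒≱ k<p)
...   | inj₂ p∣[p∸k]! = contradiction (prime∣n!⇒p≤n p-prime (p ∸ k) p∣[p∸k]!) (ℕ.<⇒≱ (ℕ.∸-monoʳ-< 0<k (ℕ.<⇒≤ k<p)))

prime∤⇒coprime : ∀ {p u} → Prime p → p ∤ u → Coprime p u
prime∤⇒coprime p-prime p∤u (d∣p , d∣u) with prime⇒irreducible p-prime d∣p
... | inj₁ d≡1 = d≡1
... | inj₂ refl = contradiction d∣u p∤u

module FieldProperties {q : ℕ} (𝔽 : FiniteField q) where
  open FiniteField 𝔽 public

  commutativeRing : CommutativeRing 0ℓ 0ℓ
  commutativeRing = record { isCommutativeRing = isCommutativeRing }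

  open CommutativeRing commutativeRing public
    using ( _-_; +-assoc; +-comm; +-identityˡ; +-identityʳ; -‿inverseʳ
          ; *-assoc; *-comm; *-identityˡ; *-identityʳ; distribˡ; distribʳ; zeroˡ; zeroʳ
          ; semiring; commutativeSemiring )
  open import Algebra.Properties.CommutativeSemigroup (CommutativeRing.*-commutativeSemigroup commutativeRing) public
    using (interchange)
  open import Algebra.Properties.CommutativeSemigroup (CommutativeRing.+-commutativeSemigroup commutativeRing) public
    using () renaming (xy∙z≈xz∙y to +-xy∙z≈xz∙y)
  open import Algebra.Properties.Ring (CommutativeRing.ring commutativeRing) public
    using (+-identityʳ-unique; +-inverseʳ-unique; //-rightDividesˡ; //-rightDividesʳ; -‿involutive; -0#≈0#; -1*x≈-x)
    renaming (x∙y⁻¹≈ε⇒x≈y to x-y≡0⇒x≡y)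
  open import Algebra.Properties.Semiring.Sum semiring public
  open import Algebra.Properties.Semiring.Mult semiring public using (×1-homo-*; ×-assoc-*; ×-comm-*)
  open import Algebra.Definitions.RawSemiring (Semiring.rawSemiring semiring) public
    using () renaming (_×_ to _⊠_; _^_ to _^ᶠ_)

  module Binomial = BinomialTheorem commutativeSemiring

  open ≡-Reasoning

  element : Fin q → F
  element = Inverse.to enum

  index : F → Fin q
  index = Inverse.from enum

  element-index : ∀ x → element (index x) ≡ x
  element-index = Inverse.strictlyInverseˡ enum

  index-element : ∀ i → index (element i) ≡ i
  index-element = Inverse.strictlyInverseʳ enum

  element-injective : ∀ {i j} → element i ≡ element j → i ≡ j
  element-injective {i} {j} e = trans (sym (index-element i)) (trans (cong index e) (index-element j))

  index-injective : ∀ {x y} → index x ≡ index y → x ≡ y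
  index-injective {x} {y} e = trans (sym (element-index x)) (trans (cong element e) (element-index y))

  2≤q : 2 ≤ q
  2≤q = Fin.injective⇒≤ {f = index ∘ zero-or-one} injective
    where
    zero-or-one : Fin 2 → F
    zero-or-one 0F          = 0#
    zero-or-one (Fin.suc _) = 1#
    injective : ∀ {i j} → index (zero-or-one i) ≡ index (zero-or-one j) → i ≡ j
    injective {0F}         {0F}         _ = refl
    injective {0F}         {Fin.suc 0F} e = contradiction (index-injective e) 0≢1
    injective {Fin.suc 0F} {0F}         e = contradiction (index-injective e) (0≢1 ∘ sym)
    injective {Fin.suc 0F} {Fin.suc 0F} _ = refl

  _≟_ : (x y : F) → Dec (x ≡ y)
  x ≟ y with index x Fin.≟ index y
  ... | yes e = yes (index-injective e)
  ... | no ne = no (ne ∘ cong index)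

  *-cancelˡ : ∀ x {y z} → x ≢ 0# → x * y ≡ x * z → y ≡ z
  *-cancelˡ x {y} {z} x≢0 e with inverse x x≢0
  ... | x⁻¹ , xx⁻¹≡1 = begin
    y              ≡⟨ sym (*-identityˡ y) ⟩
    1# * y         ≡⟨ cong (_* y) x⁻¹x≡1 ⟨
    (x⁻¹ * x) * y  ≡⟨ *-assoc x⁻¹ x y ⟩
    x⁻¹ * (x * y)  ≡⟨ cong (x⁻¹ *_) e ⟩
    x⁻¹ * (x * z)  ≡⟨ *-assoc x⁻¹ x z ⟨
    (x⁻¹ * x) * z  ≡⟨ cong (_* z) x⁻¹x≡1 ⟩
    1# * z         ≡⟨ *-identityˡ z ⟩
    z              ∎
    where x⁻¹x≡1 = trans (*-comm x⁻¹ x) xx⁻¹≡1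

  x*y≡0⇒x≡0∨y≡0 : ∀ x y → x * y ≡ 0# → x ≡ 0# ⊎ y ≡ 0#
  x*y≡0⇒x≡0∨y≡0 x y e with x ≟ 0#
  ... | yes x≡0 = inj₁ x≡0
  ... | no x≢0  = inj₂ (*-cancelˡ x x≢0 (trans e (sym (zeroʳ x))))

  x*y≡0∧y≢0⇒x≡0 : ∀ x y → x * y ≡ 0# → y ≢ 0# → x ≡ 0#
  x*y≡0∧y≢0⇒x≡0 x y xy≡0 y≢0 = *-cancelˡ y y≢0 (trans (*-comm y x) (trans xy≡0 (sym (zeroʳ y))))

  -1≢0 : - 1# ≢ 0#
  -1≢0 e = 0≢1 (sym (trans (sym (-‿involutive 1#)) (trans (cong -_ e) -0#≈0#)))

  x*x≡1⇒x≡1∨x≡-1 : ∀ x → x * x ≡ 1# → x ≡ 1# ⊎ x ≡ - 1#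
  x*x≡1⇒x≡1∨x≡-1 x xx≡1 with x*y≡0⇒x≡0∨y≡0 (x - 1#) (x + 1#) factor
    where
    factor : (x - 1#) * (x + 1#) ≡ 0#
    factor = begin
      (x - 1#) * (x + 1#)                 ≡⟨ distribʳ (x + 1#) x (- 1#) ⟩
      x * (x + 1#) + - 1# * (x + 1#)      ≡⟨ cong₂ _+_ (distribˡ x x 1#) (-1*x≈-x (x + 1#)) ⟩
      (x * x + x * 1#) + - (x + 1#)       ≡⟨ cong₂ (λ a b → (a + b) + - (x + 1#)) xx≡1 (*-identityʳ x) ⟩
      (1# + x) + - (x + 1#)               ≡⟨ cong (λ a → a + - (x + 1#)) (+-comm 1# x) ⟩
      (x + 1#) - (x + 1#)                 ≡⟨ -‿inverseʳ (x + 1#) ⟩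
      0#                                  ∎
  ... | inj₁ x-1≡0 = inj₁ (x-y≡0⇒x≡y x 1# x-1≡0)
  ... | inj₂ x+1≡0 = inj₂ (+-inverseʳ-unique 1# x (trans (+-comm 1# x) x+1≡0))

  x*x≡1∧x≢1⇒x≡-1 : ∀ x → x * x ≡ 1# → x ≢ 1# → x ≡ - 1#
  x*x≡1∧x≢1⇒x≡-1 x xx≡1 x≢1 with x*x≡1⇒x≡1∨x≡-1 x xx≡1
  ... | inj₁ x≡1  = contradiction x≡1 x≢1
  ... | inj₂ x≡-1 = x≡-1

  pow≡^ᶠ : ∀ x n → pow x n ≡ x ^ᶠ n
  pow≡^ᶠ x zero    = refl
  pow≡^ᶠ x (suc n) = cong (x *_) (pow≡^ᶠ x n)

  pow-+ : ∀ x m n → pow x (m ℕ.+ n) ≡ pow x m * pow x n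
  pow-+ x zero    n = sym (*-identityˡ _)
  pow-+ x (suc m) n = trans (cong (x *_) (pow-+ x m n)) (sym (*-assoc x _ _))

  pow-* : ∀ x m n → pow x (m ℕ.* n) ≡ pow (pow x m) n
  pow-* x m zero    = cong (pow x) (ℕ.*-zeroʳ m)
  pow-* x m (suc n) = begin
    pow x (m ℕ.* suc n)           ≡⟨ cong (pow x) (ℕ.*-suc m n) ⟩
    pow x (m ℕ.+ m ℕ.* n)         ≡⟨ pow-+ x m (m ℕ.* n) ⟩
    pow x m * pow x (m ℕ.* n)     ≡⟨ cong (pow x m *_) (pow-* x m n) ⟩
    pow x m * pow (pow x m) n     ∎

  pow-comm : ∀ x m n → pow (pow x m) n ≡ pow (pow x n) m
  pow-comm x m n = trans (sym (pow-* x m n)) (trans (cong (pow x) (ℕ.*-comm m n)) (pow-* x n m))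

  pow-distrib-* : ∀ x y n → pow (x * y) n ≡ pow x n * pow y n
  pow-distrib-* x y zero    = sym (*-identityˡ 1#)
  pow-distrib-* x y (suc n) = begin
    (x * y) * pow (x * y) n          ≡⟨ cong ((x * y) *_) (pow-distrib-* x y n) ⟩
    (x * y) * (pow x n * pow y n)    ≡⟨ interchange x y (pow x n) (pow y n) ⟩
    (x * pow x n) * (y * pow y n)    ∎

  pow-1# : ∀ n → pow 1# n ≡ 1#
  pow-1# zero    = refl
  pow-1# (suc n) = trans (*-identityˡ _) (pow-1# n)

  pow-nonzero : ∀ x n → x ≢ 0# → pow x n ≢ 0#
  pow-nonzero x zero    x≢0 e = 0≢1 (sym e)
  pow-nonzero x (suc n) x≢0 e with x*y≡0⇒x≡0∨y≡0 x (pow x n) e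
  ... | inj₁ x≡0  = x≢0 x≡0
  ... | inj₂ xⁿ≡0 = pow-nonzero x n x≢0 xⁿ≡0

  pow≡0⇒≡0 : ∀ x n → pow x n ≡ 0# → x ≡ 0#
  pow≡0⇒≡0 x n e with x ≟ 0#
  ... | yes x≡0 = x≡0
  ... | no x≢0  = contradiction e (pow-nonzero x n x≢0)

  pow-cancelˡ : ∀ x m n → x ≢ 0# → pow x (m ℕ.+ n) ≡ pow x m → pow x n ≡ 1#
  pow-cancelˡ x m n x≢0 e = *-cancelˡ (pow x m) (pow-nonzero x m x≢0)
    (trans (sym (pow-+ x m n)) (trans e (sym (*-identityʳ _))))

  pow-% : ∀ x m → pow x m ≡ 1# → .{{_ : NonZero m}} → ∀ k → pow x k ≡ pow x (k % m)
  pow-% x m xᵐ≡1 k = begin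
    pow x k                                    ≡⟨ cong (pow x) (m≡m%n+[m/n]*n k m) ⟩
    pow x (k % m ℕ.+ (k / m) ℕ.* m)            ≡⟨ pow-+ x (k % m) _ ⟩
    pow x (k % m) * pow x ((k / m) ℕ.* m)      ≡⟨ cong (λ e → pow x (k % m) * pow x e) (ℕ.*-comm (k / m) m) ⟩
    pow x (k % m) * pow x (m ℕ.* (k / m))      ≡⟨ cong (pow x (k % m) *_) (pow-* x m (k / m)) ⟩
    pow x (k % m) * pow (pow x m) (k / m)      ≡⟨ cong (λ y → pow x (k % m) * pow y (k / m)) xᵐ≡1 ⟩
    pow x (k % m) * pow 1# (k / m)             ≡⟨ cong (pow x (k % m) *_) (pow-1# (k / m)) ⟩
    pow x (k % m) * 1#                         ≡⟨ *-identityʳ _ ⟩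
    pow x (k % m)                              ∎

  sum-single : ∀ {n} (f : Fin n → F) i → (∀ j → j ≢ i → f j ≡ 0#) → sum f ≡ f i
  sum-single {suc n} f i others = begin
    sum f                             ≡⟨ sum-remove {i = i} f ⟩
    f i + sum (removeAt f i)          ≡⟨ cong (f i +_) (sum-cong-≗ (λ j → others (Fin.punchIn i j) (Fin.punchInᵢ≢i i j))) ⟩
    f i + sum {n} (λ _ → 0#)          ≡⟨ cong (f i +_) (sum-replicate-zero n) ⟩
    f i + 0#                          ≡⟨ +-identityʳ (f i) ⟩
    f i                               ∎

  -- Translation by 1# permutes F, so ∑ x = ∑ (x + 1#) = ∑ x + q ⊠ 1#.
  q⊠1#≡0# : q ⊠ 1# ≡ 0#
  q⊠1#≡0# = +-identityʳ-unique (∑[ i < q ] element i) (q ⊠ 1#) (sym (begin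
    ∑[ i < q ] element i                       ≡⟨ ∑-permute element translation ⟩
    ∑[ i < q ] element (index (element i + 1#)) ≡⟨ sum-cong-≗ (λ i → element-index (element i + 1#)) ⟩
    ∑[ i < q ] (element i + 1#)                ≡⟨ ∑-distrib-+ element (λ _ → 1#) ⟩
    ∑[ i < q ] element i + ∑[ i < q ] 1#       ≡⟨ cong (∑[ i < q ] element i +_) (sum-replicate q) ⟩
    ∑[ i < q ] element i + q ⊠ 1#              ∎))
    where
    translation : Permutation q q
    translation = permutation (λ i → index (element i + 1#)) (λ i → index (element i - 1#))
      (λ i → trans (cong (λ x → index (x + 1#)) (element-index _))
               (trans (cong index (//-rightDividesˡ 1# (element i))) (index-element i)))
      (λ i → trans (cong (λ x → index (x - 1#)) (element-index _))
               (trans (cong index (//-rightDividesʳ 1# (element i))) (index-element i)))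

  ⊠≡⊠1#* : ∀ n x → n ⊠ x ≡ (n ⊠ 1#) * x
  ⊠≡⊠1#* n x = trans (cong (n ⊠_) (sym (*-identityˡ x))) (sym (×-assoc-* n 1# x))

  ⊠1#-^ : ∀ m e → (m ^ e) ⊠ 1# ≡ pow (m ⊠ 1#) e
  ⊠1#-^ m zero    = +-identityʳ 1#
  ⊠1#-^ m (suc e) = trans (×1-homo-* m (m ^ e)) (cong ((m ⊠ 1#) *_) (⊠1#-^ m e))

  p⊠1#≡0# : ∀ {p e} → q ≡ p ^ e → p ⊠ 1# ≡ 0#
  p⊠1#≡0# {p} {e} q≡pᵉ =
    pow≡0⇒≡0 (p ⊠ 1#) e (trans (sym (⊠1#-^ p e)) (trans (cong (_⊠ 1#) (sym q≡pᵉ)) q⊠1#≡0#))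

  binomial-+1# : ∀ x u → pow (x + 1#) u ≡ ∑[ i < suc u ] ((u C toℕ i) ⊠ pow x (toℕ i))
  binomial-+1# x u = begin
    pow (x + 1#) u                                                   ≡⟨ pow≡^ᶠ (x + 1#) u ⟩
    (x + 1#) ^ᶠ u                                                    ≡⟨ Binomial.theorem u x 1# ⟩
    ∑[ i < suc u ] ((u C toℕ i) ⊠ (x ^ᶠ toℕ i * 1# ^ᶠ (u ∸ toℕ i)))  ≡⟨ sum-cong-≗ {suc u} (λ i → cong ((u C toℕ i) ⊠_) (term i)) ⟩
    ∑[ i < suc u ] ((u C toℕ i) ⊠ pow x (toℕ i))                     ∎
    where
    term : ∀ i → x ^ᶠ toℕ i * 1# ^ᶠ (u ∸ toℕ i) ≡ pow x (toℕ i)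
    term i = begin
      x ^ᶠ toℕ i * 1# ^ᶠ (u ∸ toℕ i)     ≡⟨ cong₂ _*_ (pow≡^ᶠ x (toℕ i)) (pow≡^ᶠ 1# (u ∸ toℕ i)) ⟨
      pow x (toℕ i) * pow 1# (u ∸ toℕ i) ≡⟨ cong (pow x (toℕ i) *_) (pow-1# (u ∸ toℕ i)) ⟩
      pow x (toℕ i) * 1#                 ≡⟨ *-identityʳ _ ⟩
      pow x (toℕ i)                      ∎

  Additive : ℕ → Set
  Additive t = ∀ x y → pow (x + y) t ≡ pow x t + pow y t

  multiple⊠≡0# : ∀ {p} → p ⊠ 1# ≡ 0# → ∀ c x → (c ℕ.* p) ⊠ x ≡ 0#
  multiple⊠≡0# {p} p⊠1#≡0# c x = begin
    (c ℕ.* p) ⊠ x               ≡⟨ ⊠≡⊠1#* (c ℕ.* p) x ⟩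
    ((c ℕ.* p) ⊠ 1#) * x        ≡⟨ cong (_* x) (×1-homo-* c p) ⟩
    ((c ⊠ 1#) * (p ⊠ 1#)) * x   ≡⟨ cong (λ z → ((c ⊠ 1#) * z) * x) p⊠1#≡0# ⟩
    ((c ⊠ 1#) * 0#) * x         ≡⟨ trans (cong (_* x) (zeroʳ _)) (zeroˡ x) ⟩
    0#                          ∎

  frobenius-+ : ∀ {p} → Prime p → p ⊠ 1# ≡ 0# → Additive p
  frobenius-+ {zero} p-prime = contradiction refl (ℕ.≢-nonZero⁻¹ 0 {{prime⇒nonZero p-prime}})
  frobenius-+ {p@(suc p′)} p-prime p⊠1#≡0# x y = begin
    pow (x + y) p                              ≡⟨ pow≡^ᶠ (x + y) p ⟩
    (x + y) ^ᶠ p                               ≡⟨ Binomial.theorem p x y ⟩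
    term 0F + ∑[ j < p ] term (Fin.suc j)      ≡⟨ cong₂ _+_ first (sum-single (term ∘ Fin.suc) (fromℕ p′) middle) ⟩
    pow y p + term (Fin.suc (fromℕ p′))        ≡⟨ cong (pow y p +_) last ⟩
    pow y p + pow x p                          ≡⟨ +-comm (pow y p) (pow x p) ⟩
    pow x p + pow y p                          ∎
    where
    term = Binomial.binomialTerm x y p
    first : term 0F ≡ pow y p
    first = begin
      (p C 0) ⊠ (1# * y ^ᶠ p)    ≡⟨ cong (_⊠ (1# * y ^ᶠ p)) (trans (nCk≡nC[n∸k] {0} {p} z≤n) (nCn≡1 p)) ⟩
      1 ⊠ (1# * y ^ᶠ p)          ≡⟨ +-identityʳ _ ⟩
      1# * y ^ᶠ p                ≡⟨ *-identityˡ _ ⟩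
      y ^ᶠ p                     ≡⟨ pow≡^ᶠ y p ⟨
      pow y p                    ∎
    last : term (Fin.suc (fromℕ p′)) ≡ pow x p
    last = begin
      (p C suc (toℕ (fromℕ p′))) ⊠ (x ^ᶠ suc (toℕ (fromℕ p′)) * y ^ᶠ (p′ ∸ toℕ (fromℕ p′)))
                                 ≡⟨ cong (λ k → (p C suc k) ⊠ (x ^ᶠ suc k * y ^ᶠ (p′ ∸ k))) (Fin.toℕ-fromℕ p′) ⟩
      (p C p) ⊠ (x ^ᶠ p * y ^ᶠ (p′ ∸ p′))
                                 ≡⟨ cong₂ _⊠_ (nCn≡1 p) (cong (λ k → x ^ᶠ p * y ^ᶠ k) (ℕ.n∸n≡0 p′)) ⟩
      1 ⊠ (x ^ᶠ p * 1#)          ≡⟨ +-identityʳ _ ⟩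
      x ^ᶠ p * 1#                ≡⟨ *-identityʳ _ ⟩
      x ^ᶠ p                     ≡⟨ pow≡^ᶠ x p ⟨
      pow x p                    ∎
    middle : ∀ j → j ≢ fromℕ p′ → term (Fin.suc j) ≡ 0#
    middle j j≢p′ with prime∣pCk p-prime (s≤s z≤n) (s≤s j<p′)
      where
      j<p′ : toℕ j < p′
      j<p′ = ℕ.≤∧≢⇒< (Fin.toℕ≤pred[n] j) (j≢p′ ∘ Fin.toℕ-injective ∘ (λ e → trans e (sym (Fin.toℕ-fromℕ p′))))
    ... | divides c pCk≡c*p =
      trans (cong (_⊠ Binomial.binomial x y p (Fin.suc j)) pCk≡c*p) (multiple⊠≡0# p⊠1#≡0# c _)

  -- Multiplying by y rotates y⁰, …, yⁿ cyclically since yⁿ⁺¹ = 1#, so y S = S.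
  geometric-sum≡0 : ∀ y n → pow y (suc n) ≡ 1# → y ≢ 1# → ∑[ a < suc n ] pow y (toℕ a) ≡ 0#
  geometric-sum≡0 y n y¹⁺ⁿ≡1 y≢1 with (∑[ a < suc n ] pow y (toℕ a)) ≟ 0#
  ... | yes S≡0 = S≡0
  ... | no S≢0  = contradiction (*-cancelˡ S S≢0 (begin
    S * y                                      ≡⟨ *-comm S y ⟩
    y * S                                      ≡⟨ *-distribˡ-sum {suc n} y (λ a → pow y (toℕ a)) ⟩
    ∑[ a < suc n ] pow y (suc (toℕ a))         ≡⟨ sum-init-last {n} (λ a → pow y (suc (toℕ a))) ⟩
    ∑[ a < n ] pow y (suc (toℕ (Fin.inject₁ a))) + pow y (suc (toℕ (fromℕ n)))
                                               ≡⟨ cong₂ _+_ (sum-cong-≗ {n} (λ a → cong (pow y ∘ suc) (Fin.toℕ-inject₁ a)))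
                                                            (trans (cong (pow y ∘ suc) (Fin.toℕ-fromℕ n)) y¹⁺ⁿ≡1) ⟩
    ∑[ a < n ] pow y (suc (toℕ a)) + 1#        ≡⟨ +-comm _ 1# ⟩
    S                                          ≡⟨ *-identityʳ S ⟨
    S * 1#                                     ∎)) y≢1
    where S = ∑[ a < suc n ] pow y (toℕ a)

  m⊠1#≡0∧n⊠1#≡0⇒1+m≢n : ∀ m n → m ⊠ 1# ≡ 0# → n ⊠ 1# ≡ 0# → 1 ℕ.+ m ≢ n
  m⊠1#≡0∧n⊠1#≡0⇒1+m≢n m n m⊠1#≡0# n⊠1#≡0# 1+m≡n = 0≢1 (sym (begin
    1#              ≡⟨ +-identityʳ 1# ⟨
    1# + 0#         ≡⟨ cong (1# +_) m⊠1#≡0# ⟨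
    1# + m ⊠ 1#     ≡⟨ cong (_⊠ 1#) 1+m≡n ⟩
    n ⊠ 1#          ≡⟨ n⊠1#≡0# ⟩
    0#              ∎))

  module CharacteristicPrime {p} (p-prime : Prime p) (p⊠1#≡0# : p ⊠ 1# ≡ 0#) where

    frobenius^-+ : ∀ a → Additive (p ^ a)
    frobenius^-+ zero    x y = trans (*-identityʳ (x + y)) (sym (cong₂ _+_ (*-identityʳ x) (*-identityʳ y)))
    frobenius^-+ (suc a) x y = begin
      pow (x + y) (p ℕ.* p ^ a)                          ≡⟨ pow-* (x + y) p (p ^ a) ⟩
      pow (pow (x + y) p) (p ^ a)                        ≡⟨ cong (λ z → pow z (p ^ a)) (frobenius-+ p-prime p⊠1#≡0# x y) ⟩
      pow (pow x p + pow y p) (p ^ a)                    ≡⟨ frobenius^-+ a (pow x p) (pow y p) ⟩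
      pow (pow x p) (p ^ a) + pow (pow y p) (p ^ a)      ≡⟨ cong₂ _+_ (pow-* x p (p ^ a)) (pow-* y p (p ^ a)) ⟨
      pow x (p ℕ.* p ^ a) + pow y (p ℕ.* p ^ a)          ∎

    frobenius-injective : ∀ {x y} → pow x p ≡ pow y p → x ≡ y
    frobenius-injective {x} {y} xᵖ≡yᵖ = x-y≡0⇒x≡y x y (pow≡0⇒≡0 (x - y) p (+-identityʳ-unique (pow y p) _ (begin
      pow y p + pow (x - y) p     ≡⟨ +-comm (pow y p) _ ⟩
      pow (x - y) p + pow y p     ≡⟨ frobenius-+ p-prime p⊠1#≡0# (x - y) y ⟨
      pow ((x - y) + y) p         ≡⟨ cong (λ z → pow z p) (//-rightDividesˡ y x) ⟩
      pow x p                     ≡⟨ xᵖ≡yᵖ ⟩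
      pow y p                     ∎)))

    p∤u⇒u⊠1#≢0# : ∀ {u} → p ∤ u → u ⊠ 1# ≢ 0#
    p∤u⇒u⊠1#≢0# {u} p∤u u⊠1#≡0# with coprime-Bézout (prime∤⇒coprime p-prime p∤u)
    ... | Bézout.+- x y 1+yu≡xp =
      m⊠1#≡0∧n⊠1#≡0⇒1+m≢n (y ℕ.* u) (x ℕ.* p) (multiple⊠≡0# u⊠1#≡0# y 1#) (multiple⊠≡0# p⊠1#≡0# x 1#) 1+yu≡xp
    ... | Bézout.-+ x y 1+xp≡yu =
      m⊠1#≡0∧n⊠1#≡0⇒1+m≢n (x ℕ.* p) (y ℕ.* u) (multiple⊠≡0# p⊠1#≡0# x 1#) (multiple⊠≡0# u⊠1#≡0# y 1#) 1+xp≡yu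

module MultiplicativeGroup {r : ℕ} (𝔽 : FiniteField (suc (suc r))) where
  open FieldProperties 𝔽
  open ≡-Reasoning

  N : ℕ
  N = suc r

  N⊠1#≡-1# : N ⊠ 1# ≡ - 1#
  N⊠1#≡-1# = +-inverseʳ-unique 1# (N ⊠ 1#) q⊠1#≡0#

  module Order {ω : F} (ω-gen : IsGenerator ω) where

    ω≢0 : ω ≢ 0#
    ω≢0 = proj₁ ω-gen

    period⇒N≤ : ∀ m → 0 < m → pow ω m ≡ 1# → N ≤ m
    period⇒N≤ m@(suc _) _ ωᵐ≡1 = ℕ.≤-pred (Fin.injective⇒≤ label∘element-injective)
      where
      -- F embeds into Fin (1 + m) by 0# ↦ 0 and ωᵏ ↦ 1 + k mod m
      label : F → Fin (suc m)
      label x with x ≟ 0#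
      ... | yes _  = Fin.zero
      ... | no x≢0 = Fin.suc (fromℕ< (m%n<n (proj₁ (proj₂ ω-gen x x≢0)) m))
      unlabel : Fin (suc m) → F
      unlabel Fin.zero    = 0#
      unlabel (Fin.suc i) = pow ω (toℕ i)
      unlabel∘label : ∀ x → unlabel (label x) ≡ x
      unlabel∘label x with x ≟ 0#
      ... | yes x≡0 = sym x≡0
      ... | no x≢0  = let (k , ωᵏ≡x) = proj₂ ω-gen x x≢0 in
        trans (cong (pow ω) (Fin.toℕ-fromℕ< (m%n<n k m))) (trans (sym (pow-% ω m ωᵐ≡1 k)) ωᵏ≡x)
      label∘element-injective : ∀ {i j} → label (element i) ≡ label (element j) → i ≡ j
      label∘element-injective e =
        element-injective (trans (sym (unlabel∘label _)) (trans (cong unlabel e) (unlabel∘label _)))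

    index0#≢indexωⁱ : ∀ i → index 0# ≢ index (pow ω i)
    index0#≢indexωⁱ i = pow-nonzero ω i ω≢0 ∘ sym ∘ index-injective

    -- the position of ωⁱ among the N nonzero elements
    position : Fin (suc N) → Fin N
    position i = punchOut (index0#≢indexωⁱ (toℕ i))

    ∃period≤N : ∃ λ m → 0 < m × m ≤ N × pow ω m ≡ 1#
    ∃period≤N with Fin.pigeonhole (ℕ.n<1+n N) position
    ... | i , j , i<j , same-position =
      toℕ j ∸ toℕ i , ℕ.m<n⇒0<n∸m i<j , ℕ.≤-trans (ℕ.m∸n≤m (toℕ j) (toℕ i)) (ℕ.≤-pred (Fin.toℕ<n j)) ,
      pow-cancelˡ ω (toℕ i) (toℕ j ∸ toℕ i) ω≢0 (trans (cong (pow ω) (ℕ.m+[n∸m]≡n (ℕ.<⇒≤ i<j))) (sym ωⁱ≡ωʲ))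
      where
      ωⁱ≡ωʲ : pow ω (toℕ i) ≡ pow ω (toℕ j)
      ωⁱ≡ωʲ = index-injective (Fin.punchOut-injective (index0#≢indexωⁱ (toℕ i)) (index0#≢indexωⁱ (toℕ j)) same-position)

    ω^N≡1 : pow ω N ≡ 1#
    ω^N≡1 = let m , 0<m , m≤N , ωᵐ≡1 = ∃period≤N in
      subst (λ k → pow ω k ≡ 1#) (ℕ.≤-antisym m≤N (period⇒N≤ m 0<m ωᵐ≡1)) ωᵐ≡1

    ω^j≢1 : ∀ {j} → 0 < j → j < N → pow ω j ≢ 1#
    ω^j≢1 0<j j<N ωʲ≡1 = ℕ.<⇒≱ j<N (period⇒N≤ _ 0<j ωʲ≡1)

    ω^[N+j]≡ω^j : ∀ j → pow ω (N ℕ.+ j) ≡ pow ω j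
    ω^[N+j]≡ω^j j = trans (pow-+ ω N j) (trans (cong (_* pow ω j) ω^N≡1) (*-identityˡ _))

    ω^m≡1⇒m%N≡0 : ∀ {m} → pow ω m ≡ 1# → m % N ≡ 0
    ω^m≡1⇒m%N≡0 {m} ωᵐ≡1 = ℕ.n≤0⇒n≡0 (ℕ.≮⇒≥ (λ 0<m%N →
      ω^j≢1 0<m%N (m%n<n m N) (trans (sym (pow-% ω N ω^N≡1 m)) ωᵐ≡1)))

    log : ∀ x → x ≢ 0# → ∃ λ i → i < N × pow ω i ≡ x
    log x x≢0 with proj₂ ω-gen x x≢0
    ... | k , ωᵏ≡x = k % N , m%n<n k N , trans (sym (pow-% ω N ω^N≡1 k)) ωᵏ≡x

    fermat : ∀ x → pow x (suc N) ≡ x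
    fermat x with x ≟ 0#
    ... | yes x≡0 = trans (cong (λ y → pow y (suc N)) x≡0) (trans (zeroˡ _) (sym x≡0))
    ... | no x≢0  = let i , _ , ωⁱ≡x = log x x≢0 in subst (λ y → pow y (suc N) ≡ y) ωⁱ≡x (begin
      pow ω i * pow (pow ω i) N    ≡⟨ cong (pow ω i *_) (pow-comm ω i N) ⟩
      pow ω i * pow (pow ω N) i    ≡⟨ cong (λ y → pow ω i * pow y i) ω^N≡1 ⟩
      pow ω i * pow 1# i           ≡⟨ cong (pow ω i *_) (pow-1# i) ⟩
      pow ω i * 1#                 ≡⟨ *-identityʳ _ ⟩
      pow ω i                      ∎)

    ω^[_] : Fin N → F
    ω^[ a ] = pow ω (toℕ a)

    powerSum : ℕ → F
    powerSum m = ∑[ a < N ] pow ω^[ a ] m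

    powerSum≢1⇒≡0 : ∀ m → pow ω m ≢ 1# → powerSum m ≡ 0#
    powerSum≢1⇒≡0 m ωᵐ≢1 = trans (sum-cong-≗ {N} (λ a → pow-comm ω (toℕ a) m)) (geometric-sum≡0 (pow ω m) r ωᵐᴺ≡1 ωᵐ≢1)
      where
      ωᵐᴺ≡1 : pow (pow ω m) N ≡ 1#
      ωᵐᴺ≡1 = trans (pow-comm ω m N) (trans (cong (λ y → pow y m) ω^N≡1) (pow-1# m))

    powerSum-N≡-1 : powerSum N ≡ - 1#
    powerSum-N≡-1 = begin
      ∑[ a < N ] pow ω^[ a ] N          ≡⟨ sum-cong-≗ {N} (λ a → pow-comm ω (toℕ a) N) ⟩
      ∑[ a < N ] pow (pow ω N) (toℕ a)  ≡⟨ sum-cong-≗ {N} (λ a → trans (cong (λ y → pow y (toℕ a)) ω^N≡1) (pow-1# (toℕ a))) ⟩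
      ∑[ a < N ] 1#                     ≡⟨ sum-replicate N ⟩
      N ⊠ 1#                            ≡⟨ N⊠1#≡-1# ⟩
      - 1#                              ∎

    powerSum[r+2+k]≡0 : ∀ k → suc k < N → powerSum (r ℕ.+ suc (suc k)) ≡ 0#
    powerSum[r+2+k]≡0 k 1+k<N = powerSum≢1⇒≡0 (r ℕ.+ suc (suc k)) (λ ωʳ⁺²⁺ᵏ≡1 → ω^j≢1 (s≤s z≤n) 1+k<N (begin
      pow ω (suc k)              ≡⟨ ω^[N+j]≡ω^j (suc k) ⟨
      pow ω (N ℕ.+ suc k)        ≡⟨ cong (pow ω) (ℕ.+-suc r (suc k)) ⟨
      pow ω (r ℕ.+ suc (suc k))  ≡⟨ ωʳ⁺²⁺ᵏ≡1 ⟩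
      1#                         ∎))

    powerSum-r≡0 : ∀ {u} → suc (suc u) < N → powerSum r ≡ 0#
    powerSum-r≡0 2+u<N = powerSum≢1⇒≡0 r (ω^j≢1 (ℕ.≤-trans (s≤s z≤n) (ℕ.≤-pred 2+u<N)) (ℕ.n<1+n r))

    -- ∑ over x ≠ 0 of x⁻¹ (x + 1)ᵘ, as xʳ = x⁻¹
    twistedSum : ℕ → F
    twistedSum u = ∑[ a < N ] (pow ω^[ a ] r * pow (ω^[ a ] + 1#) u)

    twistedSum-additive : ∀ u → suc (suc u) < N → Additive (suc (suc u)) → twistedSum (suc (suc u)) ≡ 0#
    twistedSum-additive u 2+u<N additive = begin
      ∑[ a < N ] (pow (z a) r * pow (z a + 1#) (2+u))             ≡⟨ sum-cong-≗ {N} expand ⟩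
      ∑[ a < N ] (pow (z a) (r ℕ.+ 2+u) + pow (z a) r)            ≡⟨ ∑-distrib-+ {N} (λ a → pow (z a) (r ℕ.+ 2+u)) (λ a → pow (z a) r) ⟩
      powerSum (r ℕ.+ 2+u) + powerSum r                           ≡⟨ cong₂ _+_ (powerSum[r+2+k]≡0 u (ℕ.<-trans (ℕ.n<1+n (suc u)) 2+u<N))
                                                                               (powerSum-r≡0 2+u<N) ⟩
      0# + 0#                                                     ≡⟨ +-identityʳ 0# ⟩
      0#                                                          ∎
      where
      2+u = suc (suc u)
      z = ω^[_]
      expand : ∀ a → pow (z a) r * pow (z a + 1#) 2+u ≡ pow (z a) (r ℕ.+ 2+u) + pow (z a) r
      expand a = begin
        pow (z a) r * pow (z a + 1#) 2+u                ≡⟨ cong (pow (z a) r *_) (additive (z a) 1#) ⟩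
        pow (z a) r * (pow (z a) 2+u + pow 1# 2+u)      ≡⟨ cong (λ y → pow (z a) r * (pow (z a) 2+u + y)) (pow-1# 2+u) ⟩
        pow (z a) r * (pow (z a) 2+u + 1#)              ≡⟨ distribˡ (pow (z a) r) (pow (z a) 2+u) 1# ⟩
        pow (z a) r * pow (z a) 2+u + pow (z a) r * 1#  ≡⟨ cong₂ _+_ (sym (pow-+ (z a) r 2+u)) (*-identityʳ _) ⟩
        pow (z a) (r ℕ.+ 2+u) + pow (z a) r             ∎

    twistedSum-binomial : ∀ u → suc (suc u) < N → twistedSum (suc (suc u)) ≡ (suc (suc u) ⊠ 1#) * - 1#
    twistedSum-binomial u 2+u<N = begin
      ∑[ a < N ] (pow (z a) r * pow (z a + 1#) 2+u)
        ≡⟨ sum-cong-≗ {N} expand ⟩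
      ∑[ a < N ] ∑[ i < 3+u ] (c i * pow (z a) (r ℕ.+ toℕ i))
        ≡⟨ ∑-comm {N} {3+u} (λ a i → c i * pow (z a) (r ℕ.+ toℕ i)) ⟩
      ∑[ i < 3+u ] ∑[ a < N ] (c i * pow (z a) (r ℕ.+ toℕ i))
        ≡⟨ sum-cong-≗ {3+u} (λ i → sym (*-distribˡ-sum {N} (c i) (λ a → pow (z a) (r ℕ.+ toℕ i)))) ⟩
      ∑[ i < 3+u ] (c i * powerSum (r ℕ.+ toℕ i))
        ≡⟨ sum-single (λ i → c i * powerSum (r ℕ.+ toℕ i)) (Fin.suc 0F) vanishing ⟩
      c (Fin.suc 0F) * powerSum (r ℕ.+ 1)
        ≡⟨ cong₂ _*_ (cong (_⊠ 1#) (nC1≡n 2+u)) (trans (cong powerSum (ℕ.+-comm r 1)) powerSum-N≡-1) ⟩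
      (2+u ⊠ 1#) * - 1#
        ∎
      where
      2+u = suc (suc u)
      3+u = suc 2+u
      z = ω^[_]
      c : Fin 3+u → F
      c i = (2+u C toℕ i) ⊠ 1#
      term : ∀ a i → pow (z a) r * ((2+u C toℕ i) ⊠ pow (z a) (toℕ i)) ≡ c i * pow (z a) (r ℕ.+ toℕ i)
      term a i = begin
        pow (z a) r * ((2+u C toℕ i) ⊠ pow (z a) (toℕ i))  ≡⟨ ×-comm-* (2+u C toℕ i) (pow (z a) r) (pow (z a) (toℕ i)) ⟩
        (2+u C toℕ i) ⊠ (pow (z a) r * pow (z a) (toℕ i))  ≡⟨ cong ((2+u C toℕ i) ⊠_) (pow-+ (z a) r (toℕ i)) ⟨
        (2+u C toℕ i) ⊠ pow (z a) (r ℕ.+ toℕ i)            ≡⟨ ⊠≡⊠1#* (2+u C toℕ i) _ ⟩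
        c i * pow (z a) (r ℕ.+ toℕ i)                      ∎
      expand : ∀ a → pow (z a) r * pow (z a + 1#) 2+u ≡ ∑[ i < 3+u ] (c i * pow (z a) (r ℕ.+ toℕ i))
      expand a = begin
        pow (z a) r * pow (z a + 1#) 2+u                                      ≡⟨ cong (pow (z a) r *_) (binomial-+1# (z a) 2+u) ⟩
        pow (z a) r * ∑[ i < 3+u ] ((2+u C toℕ i) ⊠ pow (z a) (toℕ i))       ≡⟨ *-distribˡ-sum {3+u} (pow (z a) r) (λ i → (2+u C toℕ i) ⊠ pow (z a) (toℕ i)) ⟩
        ∑[ i < 3+u ] (pow (z a) r * ((2+u C toℕ i) ⊠ pow (z a) (toℕ i)))     ≡⟨ sum-cong-≗ {3+u} (term a) ⟩
        ∑[ i < 3+u ] (c i * pow (z a) (r ℕ.+ toℕ i))                         ∎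
      vanishing : ∀ i → i ≢ Fin.suc 0F → c i * powerSum (r ℕ.+ toℕ i) ≡ 0#
      vanishing 0F                _    = trans (cong (λ k → c 0F * powerSum k) (ℕ.+-identityʳ r))
                                               (trans (cong (c 0F *_) (powerSum-r≡0 2+u<N)) (zeroʳ _))
      vanishing (Fin.suc 0F)      1≢1  = contradiction refl 1≢1
      vanishing (Fin.suc (Fin.suc k)) _ =
        trans (cong (c (Fin.suc (Fin.suc k)) *_) (powerSum[r+2+k]≡0 (toℕ k) (ℕ.≤-<-trans (s≤s (Fin.toℕ≤pred[n] k)) (ℕ.<-trans (ℕ.n<1+n (suc u)) 2+u<N))))
              (zeroʳ _)

    additive⇒u⊠1#≡0# : ∀ u → 1 < u → u < N → Additive u → u ⊠ 1# ≡ 0#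
    additive⇒u⊠1#≡0# 1 (s≤s ())
    additive⇒u⊠1#≡0# (suc (suc u)) _ 2+u<N additive = x*y≡0∧y≢0⇒x≡0 _ (- 1#)
      (trans (sym (twistedSum-binomial u 2+u<N)) (twistedSum-additive u 2+u<N additive)) -1≢0

  generator-period : ∀ {ω ω′} → IsGenerator ω → IsGenerator ω′ → ∀ {m} → pow ω m ≡ 1# → pow ω′ m ≡ 1#
  generator-period {ω′ = ω′} ω-gen ω′-gen {m} ωᵐ≡1 = begin
    pow ω′ m        ≡⟨ pow-% ω′ N (Order.ω^N≡1 ω′-gen) m ⟩
    pow ω′ (m % N)  ≡⟨ cong (pow ω′) (Order.ω^m≡1⇒m%N≡0 ω-gen {m} ωᵐ≡1) ⟩
    1#              ∎

  common-exponent-of-minus-one : ∀ {ω ω′} → IsGenerator ω → IsGenerator ω′ → ∃ λ h → pow ω h ≡ - 1# × pow ω′ h ≡ - 1#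
  common-exponent-of-minus-one {ω} {ω′} ω-gen ω′-gen with (- 1#) ≟ 1#
  ... | yes -1≡1 = 0 , sym -1≡1 , sym -1≡1
  ... | no -1≢1  = h , ωʰ≡-1 , x*x≡1∧x≢1⇒x≡-1 (pow ω′ h) ω′ʰω′ʰ≡1 ω′ʰ≢1
    where
    h = proj₁ (Order.log ω-gen (- 1#) -1≢0)
    ωʰ≡-1 : pow ω h ≡ - 1#
    ωʰ≡-1 = proj₂ (proj₂ (Order.log ω-gen (- 1#) -1≢0))
    ω′ʰ≢1 : pow ω′ h ≢ 1#
    ω′ʰ≢1 = Order.ω^j≢1 ω′-gen (ℕ.n≢0⇒n>0 (λ h≡0 → -1≢1 (trans (sym ωʰ≡-1) (cong (pow ω) h≡0))))
                                (proj₁ (proj₂ (Order.log ω-gen (- 1#) -1≢0)))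
    ω′ʰω′ʰ≡1 : pow ω′ h * pow ω′ h ≡ 1#
    ω′ʰω′ʰ≡1 = trans (sym (pow-+ ω′ h h)) (generator-period ω-gen ω′-gen {h ℕ.+ h}
      (trans (pow-+ ω h h) (trans (cong₂ _*_ ωʰ≡-1 ωʰ≡-1) (trans (-1*x≈-x (- 1#)) (-‿involutive 1#)))))

  module _ {p} (p-prime : Prime p) (p⊠1#≡0# : p ⊠ 1# ≡ 0#) {ω} (ω-gen : IsGenerator ω) where
    open CharacteristicPrime p-prime p⊠1#≡0#
    open Order ω-gen

    -- if t = s p, additivity of xᵗ = (xˢ)ᵖ descends to xˢ because the Frobenius map is injective
    additive⇒p-power : ∀ t → t < N → Additive t → ∃ λ a → t ≡ p ^ a
    additive⇒p-power = <-rec (λ t → t < N → Additive t → ∃ λ a → t ≡ p ^ a) step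
      where
      step : ∀ t → (∀ {s} → s < t → s < N → Additive s → ∃ λ a → s ≡ p ^ a) → t < N → Additive t → ∃ λ a → t ≡ p ^ a
      step zero _ _ additive = contradiction (+-identityʳ-unique 1# 1# (sym (additive 0# 0#))) (0≢1 ∘ sym)
      step (suc zero) _ _ _  = 0 , refl
      step t@(suc (suc _)) rec t<N additive with p ∣? t
      ... | no p∤t = contradiction (additive⇒u⊠1#≡0# t (s≤s (s≤s z≤n)) t<N additive) (p∤u⇒u⊠1#≢0# p∤t)
      ... | yes (divides s@(suc _) t≡s*p) = suc a , trans t≡s*p (trans (cong (ℕ._* p) s≡pᵃ) (ℕ.*-comm (p ^ a) p))
        where
        s<t : s < t
        s<t = subst (s <_) (sym t≡s*p) (ℕ.m<m*n s p (prime>1 p-prime))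
        s-additive : Additive s
        s-additive x y = frobenius-injective (begin
          pow (pow (x + y) s) p                 ≡⟨ pow-* (x + y) s p ⟨
          pow (x + y) (s ℕ.* p)                 ≡⟨ cong (pow (x + y)) t≡s*p ⟨
          pow (x + y) t                         ≡⟨ additive x y ⟩
          pow x t + pow y t                     ≡⟨ cong₂ _+_ (trans (cong (pow x) t≡s*p) (pow-* x s p)) (trans (cong (pow y) t≡s*p) (pow-* y s p)) ⟩
          pow (pow x s) p + pow (pow y s) p     ≡⟨ frobenius-+ p-prime p⊠1#≡0# (pow x s) (pow y s) ⟨
          pow (pow x s + pow y s) p             ∎)
        s-power = rec s<t (ℕ.<-trans s<t t<N) s-additive
        a = proj₁ s-power
        s≡pᵃ = proj₂ s-power

module RowVectors {q : ℕ} (𝔽 : FiniteField q) (d : ℕ) where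
  open FieldProperties 𝔽
  open Hamming 𝔽 d
  open ≡-Reasoning

  pointwise⇒≡ : ∀ {u v : V} → (∀ i → lookup u i ≡ lookup v i) → u ≡ v
  pointwise⇒≡ eq = Pointwise-≡⇒≡ (ext eq)

  scale : F → V → V
  scale c = Vec.map (c *_)

  lookup-⊕ : ∀ u v i → lookup (u ⊕ v) i ≡ lookup u i + lookup v i
  lookup-⊕ u v i = Vec.lookup-zipWith _+_ i u v

  lookup-scale : ∀ c v i → lookup (scale c v) i ≡ c * lookup v i
  lookup-scale c v i = Vec.lookup-map i (c *_) v

  lookup-· : ∀ x A j → lookup (x · A) j ≡ ∑[ i < d ] (lookup x i * A i j)
  lookup-· x A j = trans (Vec.lookup∘tabulate _ j) (foldr-tabulate (λ i → lookup x i * A i j))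
    where
    foldr-tabulate : ∀ {k} (g : Fin k → F) → Vec.foldr (λ _ → F) _+_ 0# (tabulate g) ≡ sum g
    foldr-tabulate {zero}  g = refl
    foldr-tabulate {suc k} g = cong (g Fin.zero +_) (foldr-tabulate (g ∘ Fin.suc))

  scale-· : ∀ c u A → scale c u · A ≡ scale c (u · A)
  scale-· c u A = pointwise⇒≡ λ j → begin
    lookup (scale c u · A) j                 ≡⟨ lookup-· (scale c u) A j ⟩
    ∑[ i < d ] (lookup (scale c u) i * A i j) ≡⟨ sum-cong-≗ {d} (λ i → trans (cong (_* A i j) (lookup-scale c u i)) (*-assoc c _ _)) ⟩
    ∑[ i < d ] (c * (lookup u i * A i j))    ≡⟨ *-distribˡ-sum {d} c (λ i → lookup u i * A i j) ⟨
    c * ∑[ i < d ] (lookup u i * A i j)      ≡⟨ cong (c *_) (lookup-· u A j) ⟨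
    c * lookup (u · A) j                     ≡⟨ lookup-scale c (u · A) j ⟨
    lookup (scale c (u · A)) j               ∎

  scale-·M^ : ∀ ω c x k → scale c x ·M[ ω ]^ k ≡ scale c (x ·M[ ω ]^ k)
  scale-·M^ ω c x zero    = refl
  scale-·M^ ω c x (suc k) = trans (cong (_· M ω) (scale-·M^ ω c x k)) (scale-· c (x ·M[ ω ]^ k) (M ω))

  ·M^-+ : ∀ ω x a b → x ·M[ ω ]^ (b ℕ.+ a) ≡ (x ·M[ ω ]^ a) ·M[ ω ]^ b
  ·M^-+ ω x a zero    = refl
  ·M^-+ ω x a (suc b) = cong (_· M ω) (·M^-+ ω x a b)

  scale-scale : ∀ a b v → scale a (scale b v) ≡ scale (a * b) v
  scale-scale a b v = pointwise⇒≡ λ i →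
    trans (lookup-scale a (scale b v) i) (trans (cong (a *_) (lookup-scale b v i)) (trans (sym (*-assoc a b _)) (sym (lookup-scale (a * b) v i))))

  scale-1# : ∀ v → scale 1# v ≡ v
  scale-1# v = pointwise⇒≡ λ i → trans (lookup-scale 1# v i) (*-identityˡ _)

  scale-+ : ∀ x y v → scale (x + y) v ≡ scale x v ⊕ scale y v
  scale-+ x y v = pointwise⇒≡ λ i → begin
    lookup (scale (x + y) v) i                  ≡⟨ lookup-scale (x + y) v i ⟩
    (x + y) * lookup v i                        ≡⟨ distribʳ (lookup v i) x y ⟩
    x * lookup v i + y * lookup v i             ≡⟨ cong₂ _+_ (lookup-scale x v i) (lookup-scale y v i) ⟨
    lookup (scale x v) i + lookup (scale y v) i ≡⟨ lookup-⊕ (scale x v) (scale y v) i ⟨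
    lookup (scale x v ⊕ scale y v) i            ∎

  ⊕-scale-1#-cancel : ∀ v w → (v ⊕ w) ⊕ scale (- 1#) w ≡ v
  ⊕-scale-1#-cancel v w = pointwise⇒≡ λ i → begin
    lookup ((v ⊕ w) ⊕ scale (- 1#) w) i              ≡⟨ lookup-⊕ (v ⊕ w) (scale (- 1#) w) i ⟩
    lookup (v ⊕ w) i + lookup (scale (- 1#) w) i     ≡⟨ cong₂ _+_ (lookup-⊕ v w i) (lookup-scale (- 1#) w i) ⟩
    (lookup v i + lookup w i) + - 1# * lookup w i    ≡⟨ cong ((lookup v i + lookup w i) +_) (-1*x≈-x (lookup w i)) ⟩
    (lookup v i + lookup w i) - lookup w i           ≡⟨ //-rightDividesʳ (lookup w i) (lookup v i) ⟩
    lookup v i                                       ∎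

  ⊕-cancel⇒≡scale-1# : ∀ a b w → (a ⊕ b) ⊕ w ≡ a → w ≡ scale (- 1#) b
  ⊕-cancel⇒≡scale-1# a b w a+b+w≡a = pointwise⇒≡ λ i → begin
    lookup w i                    ≡⟨ +-inverseʳ-unique (lookup b i) (lookup w i) (bᵢ+wᵢ≡0 i) ⟩
    - lookup b i                  ≡⟨ -1*x≈-x (lookup b i) ⟨
    - 1# * lookup b i             ≡⟨ lookup-scale (- 1#) b i ⟨
    lookup (scale (- 1#) b) i     ∎
    where
    bᵢ+wᵢ≡0 : ∀ i → lookup b i + lookup w i ≡ 0#
    bᵢ+wᵢ≡0 i = +-identityʳ-unique (lookup a i) _ (begin
      lookup a i + (lookup b i + lookup w i)   ≡⟨ +-assoc (lookup a i) _ _ ⟨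
      (lookup a i + lookup b i) + lookup w i   ≡⟨ cong (_+ lookup w i) (lookup-⊕ a b i) ⟨
      lookup (a ⊕ b) i + lookup w i            ≡⟨ lookup-⊕ (a ⊕ b) w i ⟨
      lookup ((a ⊕ b) ⊕ w) i                   ≡⟨ cong (λ v → lookup v i) a+b+w≡a ⟩
      lookup a i                               ∎)

  unit : ℕ → V
  unit k = tabulate (λ i → if ⌊ toℕ i ℕ.≟ k ⌋ then 1# else 0#)

  lookup-unit : ∀ k i → lookup (unit k) i ≡ (if ⌊ toℕ i ℕ.≟ k ⌋ then 1# else 0#)
  lookup-unit k i = Vec.lookup∘tabulate _ i

  unit·A : ∀ i A j → lookup (unit (toℕ i) · A) j ≡ A i j
  unit·A i A j = begin
    lookup (unit (toℕ i) · A) j                   ≡⟨ lookup-· (unit (toℕ i)) A j ⟩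
    ∑[ l < d ] (lookup (unit (toℕ i)) l * A l j)  ≡⟨ sum-single _ i others ⟩
    lookup (unit (toℕ i)) i * A i j               ≡⟨ cong (_* A i j) (trans (lookup-unit (toℕ i) i) (cong (if_then 1# else 0#) (⌊⌋-yes (toℕ i ℕ.≟ toℕ i) refl))) ⟩
    1# * A i j                                    ≡⟨ *-identityˡ _ ⟩
    A i j                                         ∎
    where
    others : ∀ l → l ≢ i → lookup (unit (toℕ i)) l * A l j ≡ 0#
    others l l≢i = trans (cong (_* A l j) (trans (lookup-unit (toℕ i) l)
                     (cong (if_then 1# else 0#) (⌊⌋-no (toℕ l ℕ.≟ toℕ i) (l≢i ∘ Fin.toℕ-injective))))) (zeroˡ _)

  unit·M : ∀ ω i → suc (toℕ i) < d → unit (toℕ i) · M ω ≡ unit (suc (toℕ i))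
  unit·M ω i 2+i≤d = pointwise⇒≡ λ j → begin
    lookup (unit (toℕ i) · M ω) j  ≡⟨ unit·A i (M ω) j ⟩
    M ω i j                        ≡⟨ cong (if ⌊ toℕ j ℕ.≟ suc (toℕ i) ⌋ then 1# else_) (cong (if_then _ else 0#) (⌊⌋-no (toℕ i ℕ.≟ d ∸ 1) not-last)) ⟩
    (if ⌊ toℕ j ℕ.≟ suc (toℕ i) ⌋ then 1# else 0#) ≡⟨ lookup-unit (suc (toℕ i)) j ⟨
    lookup (unit (suc (toℕ i))) j  ∎
    where
    not-last : toℕ i ≢ d ∸ 1
    not-last i≡d-1 = ℕ.<⇒≱ 2+i≤d (subst (d ℕ.≤_) (cong suc (sym i≡d-1)) (ℕ.m≤n+m∸n d 1))

  unit·M-last : ∀ ω i → suc (toℕ i) ≡ d → unit (toℕ i) · M ω ≡ scale ω e₁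
  unit·M-last ω i 1+i≡d = pointwise⇒≡ λ j → begin
    lookup (unit (toℕ i) · M ω) j                       ≡⟨ unit·A i (M ω) j ⟩
    M ω i j                                             ≡⟨ cong (if_then 1# else last-row j) (⌊⌋-no (toℕ j ℕ.≟ suc (toℕ i)) j≢1+i) ⟩
    last-row j                                          ≡⟨ cong (if_then (if ⌊ toℕ j ℕ.≟ 0 ⌋ then ω else 0#) else 0#) (⌊⌋-yes (toℕ i ℕ.≟ d ∸ 1) (cong (_∸ 1) 1+i≡d)) ⟩
    (if ⌊ toℕ j ℕ.≟ 0 ⌋ then ω else 0#)                ≡⟨ if-cong₂ ⌊ toℕ j ℕ.≟ 0 ⌋ (*-identityʳ ω) (zeroʳ ω) ⟨
    (if ⌊ toℕ j ℕ.≟ 0 ⌋ then ω * 1# else ω * 0#)       ≡⟨ if-float (ω *_) ⌊ toℕ j ℕ.≟ 0 ⌋ ⟨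
    ω * (if ⌊ toℕ j ℕ.≟ 0 ⌋ then 1# else 0#)           ≡⟨ cong (ω *_) (lookup-unit 0 j) ⟨
    ω * lookup e₁ j                                     ≡⟨ lookup-scale ω e₁ j ⟨
    lookup (scale ω e₁) j                               ∎
    where
    last-row : Fin d → F
    last-row j = if ⌊ toℕ i ℕ.≟ d ∸ 1 ⌋ then (if ⌊ toℕ j ℕ.≟ 0 ⌋ then ω else 0#) else 0#
    j≢1+i : ∀ {j} → toℕ j ≢ suc (toℕ i)
    j≢1+i {j} j≡1+i = ℕ.<-irrefl (trans j≡1+i 1+i≡d) (Fin.toℕ<n j)

module GeneratorSequence {r : ℕ} (𝔽 : FiniteField (suc (suc r))) (d′ : ℕ) where
  open FieldProperties 𝔽
  open MultiplicativeGroup 𝔽 using (N)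
  open Hamming 𝔽 (suc d′)
  open RowVectors 𝔽 (suc d′)
  open ≡-Reasoning

  d : ℕ
  d = suc d′

  s : F → ℕ → V
  s ω m = e₁ ·M[ ω ]^ m

  s-+ : ∀ ω a b → s ω (b ℕ.+ a) ≡ s ω a ·M[ ω ]^ b
  s-+ ω = ·M^-+ ω e₁

  s-unit : ∀ ω m → m < d → s ω m ≡ unit m
  s-unit ω zero    _     = refl
  s-unit ω (suc m) 1+m<d = begin
    s ω m · M ω            ≡⟨ cong (_· M ω) (s-unit ω m m<d) ⟩
    unit m · M ω           ≡⟨ cong (λ k → unit k · M ω) toℕi≡m ⟨
    unit (toℕ i) · M ω     ≡⟨ unit·M ω i (subst (λ k → suc k < d) (sym toℕi≡m) 1+m<d) ⟩
    unit (suc (toℕ i))     ≡⟨ cong (unit ∘ suc) toℕi≡m ⟩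
    unit (suc m)           ∎
    where
    m<d = ℕ.<-trans (ℕ.n<1+n m) 1+m<d
    i = fromℕ< m<d
    toℕi≡m = Fin.toℕ-fromℕ< m<d

  s-d : ∀ ω → s ω d ≡ scale ω e₁
  s-d ω = begin
    s ω d′ · M ω                   ≡⟨ cong (_· M ω) (s-unit ω d′ (ℕ.n<1+n d′)) ⟩
    unit d′ · M ω                  ≡⟨ cong (λ k → unit k · M ω) (Fin.toℕ-fromℕ d′) ⟨
    unit (toℕ (fromℕ d′)) · M ω    ≡⟨ unit·M-last ω (fromℕ d′) (cong suc (Fin.toℕ-fromℕ d′)) ⟩
    scale ω e₁                     ∎

  s-d* : ∀ ω h → s ω (d ℕ.* h) ≡ scale (pow ω h) e₁
  s-d* ω zero    = trans (cong (s ω) (ℕ.*-zeroʳ d)) (sym (scale-1# e₁))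
  s-d* ω (suc h) = begin
    s ω (d ℕ.* suc h)                     ≡⟨ cong (s ω) (ℕ.*-suc d h) ⟩
    s ω (d ℕ.+ d ℕ.* h)                   ≡⟨ s-+ ω (d ℕ.* h) d ⟩
    s ω (d ℕ.* h) ·M[ ω ]^ d              ≡⟨ cong (_·M[ ω ]^ d) (s-d* ω h) ⟩
    scale (pow ω h) e₁ ·M[ ω ]^ d         ≡⟨ scale-·M^ ω (pow ω h) e₁ d ⟩
    scale (pow ω h) (s ω d)               ≡⟨ cong (scale (pow ω h)) (s-d ω) ⟩
    scale (pow ω h) (scale ω e₁)          ≡⟨ scale-scale (pow ω h) ω e₁ ⟩
    scale (pow ω h * ω) e₁                ≡⟨ cong (λ c → scale c e₁) (*-comm (pow ω h) ω) ⟩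
    scale (pow ω (suc h)) e₁              ∎

  s-+d* : ∀ ω m h → s ω (m ℕ.+ d ℕ.* h) ≡ scale (pow ω h) (s ω m)
  s-+d* ω m h = begin
    s ω (m ℕ.+ d ℕ.* h)             ≡⟨ s-+ ω (d ℕ.* h) m ⟩
    s ω (d ℕ.* h) ·M[ ω ]^ m        ≡⟨ cong (_·M[ ω ]^ m) (s-d* ω h) ⟩
    scale (pow ω h) e₁ ·M[ ω ]^ m   ≡⟨ scale-·M^ ω (pow ω h) e₁ m ⟩
    scale (pow ω h) (s ω m)         ∎

  s-+n* : ∀ ω → pow ω N ≡ 1# → ∀ m k → s ω (m ℕ.+ n ℕ.* k) ≡ s ω m
  s-+n* ω ω^N≡1 m k = begin
    s ω (m ℕ.+ n ℕ.* k)             ≡⟨ cong (λ e → s ω (m ℕ.+ e)) (ℕ.*-assoc d N k) ⟩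
    s ω (m ℕ.+ d ℕ.* (N ℕ.* k))     ≡⟨ s-+d* ω m (N ℕ.* k) ⟩
    scale (pow ω (N ℕ.* k)) (s ω m) ≡⟨ cong (λ c → scale c (s ω m)) (trans (pow-* ω N k) (trans (cong (λ y → pow y k) ω^N≡1) (pow-1# k))) ⟩
    scale 1# (s ω m)                ≡⟨ scale-1# (s ω m) ⟩
    s ω m                           ∎

  s-% : ∀ ω → pow ω N ≡ 1# → ∀ a m → s ω (a ℕ.+ m % n) ≡ s ω (a ℕ.+ m)
  s-% ω ω^N≡1 a m = sym (begin
    s ω (a ℕ.+ m)                                   ≡⟨ cong (λ e → s ω (a ℕ.+ e)) (m≡m%n+[m/n]*n m n) ⟩
    s ω (a ℕ.+ (m % n ℕ.+ (m / n) ℕ.* n))           ≡⟨ cong (s ω) (sym (ℕ.+-assoc a (m % n) _)) ⟩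
    s ω ((a ℕ.+ m % n) ℕ.+ (m / n) ℕ.* n)           ≡⟨ cong (λ e → s ω ((a ℕ.+ m % n) ℕ.+ e)) (ℕ.*-comm (m / n) n) ⟩
    s ω ((a ℕ.+ m % n) ℕ.+ n ℕ.* (m / n))           ≡⟨ s-+n* ω ω^N≡1 (a ℕ.+ m % n) (m / n) ⟩
    s ω (a ℕ.+ m % n)                               ∎)

  -- the coordinate c mod d of s c = ω^(c / d) · unit (c mod d) is a power of ω
  s-nonzero : ∀ ω → ω ≢ 0# → ∀ c → ∃ λ i → lookup (s ω c) i ≢ 0#
  s-nonzero ω ω≢0 c = i , λ sᵢ≡0 → pow-nonzero ω (c / d) ω≢0 (trans (sym (*-identityʳ _)) (trans (sym sᵢ≡ωᶜᐟᵈ) sᵢ≡0))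
    where
    i = fromℕ< (m%n<n c d)
    sᵢ≡ωᶜᐟᵈ : lookup (s ω c) i ≡ pow ω (c / d) * 1#
    sᵢ≡ωᶜᐟᵈ = begin
      lookup (s ω c) i                                    ≡⟨ cong (λ e → lookup (s ω e) i) (trans (m≡m%n+[m/n]*n c d) (cong (c % d ℕ.+_) (ℕ.*-comm (c / d) d))) ⟩
      lookup (s ω (c % d ℕ.+ d ℕ.* (c / d))) i            ≡⟨ cong (λ v → lookup v i) (s-+d* ω (c % d) (c / d)) ⟩
      lookup (scale (pow ω (c / d)) (s ω (c % d))) i      ≡⟨ lookup-scale (pow ω (c / d)) (s ω (c % d)) i ⟩
      pow ω (c / d) * lookup (s ω (c % d)) i              ≡⟨ cong (λ v → pow ω (c / d) * lookup v i) (s-unit ω (c % d) (m%n<n c d)) ⟩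
      pow ω (c / d) * lookup (unit (c % d)) i             ≡⟨ cong (pow ω (c / d) *_) (trans (lookup-unit (c % d) i) (cong (if_then 1# else 0#) (⌊⌋-yes (toℕ i ℕ.≟ c % d) (Fin.toℕ-fromℕ< _)))) ⟩
      pow ω (c / d) * 1#                                  ∎

  toℕ-next : ∀ k → toℕ (next k) ≡ suc (toℕ k) % n
  toℕ-next k = Fin.toℕ-fromℕ< (m%n<n (suc (toℕ k)) n)

  next-fromℕ< : ∀ {m} (m<n : m < n) {j} → toℕ j ≡ suc m → next (fromℕ< m<n) ≡ j
  next-fromℕ< {m} m<n {j} j≡1+m = Fin.toℕ-injective (begin
    toℕ (next (fromℕ< m<n))    ≡⟨ toℕ-next (fromℕ< m<n) ⟩
    suc (toℕ (fromℕ< m<n)) % n ≡⟨ cong (λ k → suc k % n) (Fin.toℕ-fromℕ< m<n) ⟩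
    suc m % n                  ≡⟨ m<n⇒m%n≡m (subst (_< n) j≡1+m (Fin.toℕ<n j)) ⟩
    suc m                      ≡⟨ j≡1+m ⟨
    toℕ j                      ∎)

  s-next : ∀ ω → pow ω N ≡ 1# → ∀ k → s ω (toℕ (next k)) ≡ s ω (suc (toℕ k))
  s-next ω ω^N≡1 k = trans (cong (s ω) (toℕ-next k)) (s-% ω ω^N≡1 0 (suc (toℕ k)))

  -- multiplying by M^k with k = m + (n - 1)·A carries s (x + A) to s (x + m), for every x
  s-shift : ∀ ω → pow ω N ≡ 1# → ∀ a b A → s ω (a ℕ.+ A) ≡ s ω (b ℕ.+ A) → ∀ m → s ω (a ℕ.+ m) ≡ s ω (b ℕ.+ m)
  s-shift ω ω^N≡1 a b A sₐ₊ₐ≡s_b₊ₐ m =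
    trans (translate a) (trans (cong (_·M[ ω ]^ k) sₐ₊ₐ≡s_b₊ₐ) (sym (translate b)))
    where
    k = m ℕ.+ ℕ.pred n ℕ.* A
    arithmetic : ∀ m n₀ A x → (m ℕ.+ n₀ ℕ.* A) ℕ.+ (x ℕ.+ A) ≡ (x ℕ.+ m) ℕ.+ suc n₀ ℕ.* A
    arithmetic = solve-∀
    translate : ∀ x → s ω (x ℕ.+ m) ≡ s ω (x ℕ.+ A) ·M[ ω ]^ k
    translate x = begin
      s ω (x ℕ.+ m)                 ≡⟨ s-+n* ω ω^N≡1 (x ℕ.+ m) A ⟨
      s ω ((x ℕ.+ m) ℕ.+ n ℕ.* A)   ≡⟨ cong (s ω) (arithmetic m (ℕ.pred n) A x) ⟨
      s ω (k ℕ.+ (x ℕ.+ A))         ≡⟨ s-+ ω (x ℕ.+ A) k ⟩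
      s ω (x ℕ.+ A) ·M[ ω ]^ k      ∎

module Automorphism {r : ℕ} (𝔽 : FiniteField (suc (suc r))) (d′ : ℕ) where
  open FieldProperties 𝔽
  open Hamming 𝔽 (suc d′)
  open RowVectors 𝔽 (suc d′)
  open GeneratorSequence 𝔽 d′ using (s)
  open ≡-Reasoning

  module _ (α β : F → F) (β∘α : ∀ x → β (α x) ≡ x) (α∘β : ∀ x → α (β x) ≡ x)
           (α-+ : ∀ x y → α (x + y) ≡ α x + α y) (α-* : ∀ x y → α (x * y) ≡ α x * α y)
           (α-1# : α 1# ≡ 1#) where

    α-0# : α 0# ≡ 0#
    α-0# = +-identityʳ-unique (α 0#) (α 0#) (trans (sym (α-+ 0# 0#)) (cong α (+-identityʳ 0#)))

    α-sum : ∀ {m} (g : Fin m → F) → α (sum g) ≡ sum (α ∘ g)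
    α-sum {zero}  g = α-0#
    α-sum {suc m} g = trans (α-+ (g Fin.zero) (sum (g ∘ Fin.suc))) (cong (α (g Fin.zero) +_) (α-sum (g ∘ Fin.suc)))

    α-M : ∀ ω i j → α (M ω i j) ≡ M (α ω) i j
    α-M ω i j = trans (if-float α b₁) (if-cong₂ b₁ α-1#
                  (trans (if-float α b₂) (if-cong₂ b₂ (trans (if-float α b₃) (if-cong₂ b₃ refl α-0#)) α-0#)))
      where
      b₁ = ⌊ toℕ j ℕ.≟ suc (toℕ i) ⌋
      b₂ = ⌊ toℕ i ℕ.≟ suc d′ ∸ 1 ⌋
      b₃ = ⌊ toℕ j ℕ.≟ 0 ⌋

    αV : V → V
    αV = Vec.map α

    lookup-αV : ∀ v i → lookup (αV v) i ≡ α (lookup v i)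
    lookup-αV v i = Vec.lookup-map i α v

    αV-⊕ : ∀ u v → αV (u ⊕ v) ≡ αV u ⊕ αV v
    αV-⊕ u v = pointwise⇒≡ λ i → begin
      lookup (αV (u ⊕ v)) i              ≡⟨ lookup-αV (u ⊕ v) i ⟩
      α (lookup (u ⊕ v) i)               ≡⟨ cong α (lookup-⊕ u v i) ⟩
      α (lookup u i + lookup v i)        ≡⟨ α-+ (lookup u i) (lookup v i) ⟩
      α (lookup u i) + α (lookup v i)    ≡⟨ cong₂ _+_ (lookup-αV u i) (lookup-αV v i) ⟨
      lookup (αV u) i + lookup (αV v) i  ≡⟨ lookup-⊕ (αV u) (αV v) i ⟨
      lookup (αV u ⊕ αV v) i             ∎

    αV-·M : ∀ ω x → αV (x · M ω) ≡ αV x · M (α ω)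
    αV-·M ω x = pointwise⇒≡ λ j → begin
      lookup (αV (x · M ω)) j                     ≡⟨ lookup-αV (x · M ω) j ⟩
      α (lookup (x · M ω) j)                      ≡⟨ cong α (lookup-· x (M ω) j) ⟩
      α (∑[ i < suc d′ ] (lookup x i * M ω i j))  ≡⟨ α-sum (λ i → lookup x i * M ω i j) ⟩
      ∑[ i < suc d′ ] α (lookup x i * M ω i j)    ≡⟨ sum-cong-≗ {suc d′} (λ i → trans (α-* (lookup x i) (M ω i j)) (cong₂ _*_ (sym (lookup-αV x i)) (α-M ω i j))) ⟩
      ∑[ i < suc d′ ] (lookup (αV x) i * M (α ω) i j) ≡⟨ lookup-· (αV x) (M (α ω)) j ⟨
      lookup (αV x · M (α ω)) j                   ∎

    αV-e₁ : αV e₁ ≡ e₁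
    αV-e₁ = pointwise⇒≡ λ i →
      trans (lookup-αV e₁ i) (trans (cong α (lookup-unit 0 i))
        (trans (if-float α ⌊ toℕ i ℕ.≟ 0 ⌋) (trans (if-cong₂ ⌊ toℕ i ℕ.≟ 0 ⌋ α-1# α-0#) (sym (lookup-unit 0 i)))))

    αV-s : ∀ ω m → αV (s ω m) ≡ s (α ω) m
    αV-s ω zero    = αV-e₁
    αV-s ω (suc m) = trans (αV-·M ω (s ω m)) (cong (_· M (α ω)) (αV-s ω m))

    αV-head : ∀ ω x → αV (head ω x) ≡ head (α ω) (αV (proj₁ x) , proj₂ x)
    αV-head ω (v , j) = trans (αV-⊕ v (gen ω j)) (cong (αV v ⊕_) (αV-s ω (toℕ j)))

    βV∘αV : ∀ v → Vec.map β (αV v) ≡ v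
    βV∘αV v = trans (sym (Vec.map-∘ β α v)) (trans (Vec.map-cong β∘α v) (Vec.map-id v))

    αV∘βV : ∀ v → αV (Vec.map β v) ≡ v
    αV∘βV v = trans (sym (Vec.map-∘ α β v)) (trans (Vec.map-cong α∘β v) (Vec.map-id v))

    automorphism⇒iso : ∀ ω → Iso ω (α ω)
    automorphism⇒iso ω = record
      { φ      = mk↔ₛ′ (λ (v , j) → αV v , j) (λ (v , j) → Vec.map β v , j)
                       (λ (v , j) → cong (_, j) (αV∘βV v)) (λ (v , j) → cong (_, j) (βV∘αV v))
      ; comm-R = λ _ → refl
      ; comm-L = λ x y y-from-head-x head-y-is-x →
          trans (cong αV y-from-head-x) (αV-head ω x) , trans (sym (αV-head ω y)) (cong αV head-y-is-x)
      }


module IsomorphismInvariants {r : ℕ} (𝔽 : FiniteField (suc (suc r))) (d′ : ℕ) where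
  open FieldProperties 𝔽
  open MultiplicativeGroup 𝔽
  open Hamming 𝔽 (suc d′)
  open RowVectors 𝔽 (suc d′)
  open GeneratorSequence 𝔽 d′
  open ≡-Reasoning

  module _ {ω ω′ : F} (ω-gen : IsGenerator ω) (ω′-gen : IsGenerator ω′) (iso : Iso ω ω′) where
    private
      module O  = Order ω-gen
      module O′ = Order ω′-gen

    f : Dart → Dart
    f = Inverse.to (Iso.φ iso)

    σ : V → V
    σ v = proj₁ (f (v , Fin.zero))

    c : V → ℕ
    c v = toℕ (proj₂ (f (v , Fin.zero)))

    f-orbit : ∀ v m j → toℕ j ≡ m → proj₁ (f (v , j)) ≡ σ v × s ω′ (toℕ (proj₂ (f (v , j)))) ≡ s ω′ (c v ℕ.+ m)
    f-orbit v zero j j≡0 rewrite Fin.toℕ-injective {i = j} {j = Fin.zero} j≡0 =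
      refl , cong (s ω′) (sym (ℕ.+-identityʳ (c v)))
    f-orbit v (suc m) j j≡1+m = trans (cong proj₁ f[v,j]≡R[f[v,j′]]) (proj₁ previous) , (begin
      s ω′ (toℕ (proj₂ (f (v , j))))               ≡⟨ cong (s ω′ ∘ toℕ ∘ proj₂) f[v,j]≡R[f[v,j′]] ⟩
      s ω′ (toℕ (next (proj₂ (f (v , j′)))))        ≡⟨ s-next ω′ O′.ω^N≡1 (proj₂ (f (v , j′))) ⟩
      s ω′ (toℕ (proj₂ (f (v , j′)))) · M ω′        ≡⟨ cong (_· M ω′) (proj₂ previous) ⟩
      s ω′ (suc (c v ℕ.+ m))                        ≡⟨ cong (s ω′) (ℕ.+-suc (c v) m) ⟨
      s ω′ (c v ℕ.+ suc m)                          ∎)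
      where
      m<n : m < n
      m<n = ℕ.<-trans (ℕ.n<1+n m) (subst (_< n) j≡1+m (Fin.toℕ<n j))
      j′ = fromℕ< m<n
      f[v,j]≡R[f[v,j′]] : f (v , j) ≡ R (f (v , j′))
      f[v,j]≡R[f[v,j′]] = trans (cong (λ k → f (v , k)) (sym (next-fromℕ< m<n j≡1+m))) (Iso.comm-R iso (v , j′))
      previous = f-orbit v m j′ (Fin.toℕ-fromℕ< m<n)

    f-dart : ∀ v j → proj₁ (f (v , j)) ≡ σ v × s ω′ (toℕ (proj₂ (f (v , j)))) ≡ s ω′ (c v ℕ.+ toℕ j)
    f-dart v j = f-orbit v (toℕ j) j refl

    h : ℕ
    h = proj₁ (common-exponent-of-minus-one ω-gen ω′-gen)

    s-+dh : ∀ {θ} → pow θ h ≡ - 1# → ∀ m → s θ (m ℕ.+ d ℕ.* h) ≡ scale (- 1#) (s θ m)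
    s-+dh {θ} θʰ≡-1 m = trans (s-+d* θ m h) (cong (λ x → scale x (s θ m)) θʰ≡-1)

    -- the dart (v + sⱼ , reverse j) is the reverse of (v , j)
    reverse : Fin n → Fin n
    reverse j = fromℕ< (m%n<n (toℕ j ℕ.+ d ℕ.* h) n)

    s-reverse : ∀ {θ} → pow θ N ≡ 1# → ∀ m j → s θ (m ℕ.+ toℕ (reverse j)) ≡ s θ (m ℕ.+ (toℕ j ℕ.+ d ℕ.* h))
    s-reverse {θ} θ^N≡1 m j =
      trans (cong (λ k → s θ (m ℕ.+ k)) (Fin.toℕ-fromℕ< _)) (s-% θ θ^N≡1 m (toℕ j ℕ.+ d ℕ.* h))

    reversal : ∀ v j → proj₁ (f (v ⊕ s ω (toℕ j) , reverse j)) ≡ head ω′ (f (v , j))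
                     × head ω′ (f (v ⊕ s ω (toℕ j) , reverse j)) ≡ proj₁ (f (v , j))
    reversal v j = Iso.comm-L iso (v , j) (v ⊕ s ω (toℕ j) , reverse j) refl (begin
      (v ⊕ s ω (toℕ j)) ⊕ s ω (toℕ (reverse j))            ≡⟨ cong ((v ⊕ s ω (toℕ j)) ⊕_) (s-reverse O.ω^N≡1 0 j) ⟩
      (v ⊕ s ω (toℕ j)) ⊕ s ω (toℕ j ℕ.+ d ℕ.* h)          ≡⟨ cong ((v ⊕ s ω (toℕ j)) ⊕_) (s-+dh ωʰ≡-1 (toℕ j)) ⟩
      (v ⊕ s ω (toℕ j)) ⊕ scale (- 1#) (s ω (toℕ j))       ≡⟨ ⊕-scale-1#-cancel v (s ω (toℕ j)) ⟩
      v                                                    ∎)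
      where ωʰ≡-1 = proj₁ (proj₂ (common-exponent-of-minus-one ω-gen ω′-gen))

    σ-⊕ : ∀ v j → σ (v ⊕ s ω (toℕ j)) ≡ σ v ⊕ s ω′ (c v ℕ.+ toℕ j)
    σ-⊕ v j = begin
      σ (v ⊕ s ω (toℕ j))                                ≡⟨ proj₁ (f-dart (v ⊕ s ω (toℕ j)) (reverse j)) ⟨
      proj₁ (f (v ⊕ s ω (toℕ j) , reverse j))            ≡⟨ proj₁ (reversal v j) ⟩
      proj₁ (f (v , j)) ⊕ s ω′ (toℕ (proj₂ (f (v , j)))) ≡⟨ cong₂ _⊕_ (proj₁ (f-dart v j)) (proj₂ (f-dart v j)) ⟩
      σ v ⊕ s ω′ (c v ℕ.+ toℕ j)                         ∎

    c-⊕ : ∀ v j m → s ω′ (c (v ⊕ s ω (toℕ j)) ℕ.+ m) ≡ s ω′ (c v ℕ.+ m)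
    c-⊕ v j = s-shift ω′ O′.ω^N≡1 (c w) (c v) (toℕ j ℕ.+ d ℕ.* h) (begin
      s ω′ (c w ℕ.+ (toℕ j ℕ.+ d ℕ.* h))       ≡⟨ s-reverse O′.ω^N≡1 (c w) j ⟨
      s ω′ (c w ℕ.+ toℕ (reverse j))           ≡⟨ ⊕-cancel⇒≡scale-1# (σ v) (s ω′ (c v ℕ.+ toℕ j)) _ returns ⟩
      scale (- 1#) (s ω′ (c v ℕ.+ toℕ j))      ≡⟨ s-+dh ω′ʰ≡-1 (c v ℕ.+ toℕ j) ⟨
      s ω′ ((c v ℕ.+ toℕ j) ℕ.+ d ℕ.* h)       ≡⟨ cong (s ω′) (ℕ.+-assoc (c v) (toℕ j) (d ℕ.* h)) ⟩
      s ω′ (c v ℕ.+ (toℕ j ℕ.+ d ℕ.* h))       ∎)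
      where
      ω′ʰ≡-1 = proj₂ (proj₂ (common-exponent-of-minus-one ω-gen ω′-gen))
      w = v ⊕ s ω (toℕ j)
      returns : (σ v ⊕ s ω′ (c v ℕ.+ toℕ j)) ⊕ s ω′ (c w ℕ.+ toℕ (reverse j)) ≡ σ v
      returns = begin
        (σ v ⊕ s ω′ (c v ℕ.+ toℕ j)) ⊕ s ω′ (c w ℕ.+ toℕ (reverse j))
          ≡⟨ cong₂ _⊕_ (trans (proj₁ (f-dart w (reverse j))) (σ-⊕ v j)) (proj₂ (f-dart w (reverse j))) ⟨
        head ω′ (f (w , reverse j))
          ≡⟨ proj₂ (reversal v j) ⟩
        proj₁ (f (v , j))
          ≡⟨ proj₁ (f-dart v j) ⟩
        σ v
          ∎

    X : F → V
    X x = scale x e₁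

    -- the index j with sⱼ = ωᵇ e₁
    index-of : ℕ → Fin n
    index-of b = fromℕ< (m%n<n (d ℕ.* b) n)

    X-+ω^ : ∀ x b → X (x + pow ω b) ≡ X x ⊕ s ω (toℕ (index-of b))
    X-+ω^ x b = begin
      X (x + pow ω b)            ≡⟨ scale-+ x (pow ω b) e₁ ⟩
      X x ⊕ X (pow ω b)          ≡⟨ cong (X x ⊕_) (s-d* ω b) ⟨
      X x ⊕ s ω (d ℕ.* b)        ≡⟨ cong (X x ⊕_) (s-% ω O.ω^N≡1 0 (d ℕ.* b)) ⟨
      X x ⊕ s ω ((d ℕ.* b) % n)  ≡⟨ cong (λ k → X x ⊕ s ω k) (Fin.toℕ-fromℕ< (m%n<n (d ℕ.* b) n)) ⟨
      X x ⊕ s ω (toℕ (index-of b)) ∎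

    c₀ : ℕ
    c₀ = c (X 0#)

    c-X : ∀ x m → s ω′ (c (X x) ℕ.+ m) ≡ s ω′ (c₀ ℕ.+ m)
    c-X x m with x ≟ 0#
    ... | yes x≡0 = cong (λ y → s ω′ (c (X y) ℕ.+ m)) x≡0
    ... | no x≢0  = begin
      s ω′ (c (X x) ℕ.+ m)                                        ≡⟨ cong (λ v → s ω′ (c v ℕ.+ m)) X-decomposition ⟩
      s ω′ (c (X 0# ⊕ s ω (toℕ (index-of b))) ℕ.+ m)              ≡⟨ c-⊕ (X 0#) (index-of b) m ⟩
      s ω′ (c₀ ℕ.+ m)                                             ∎
      where
      b = proj₁ (O.log x x≢0)
      X-decomposition : X x ≡ X 0# ⊕ s ω (toℕ (index-of b))
      X-decomposition = trans (cong X (trans (sym (proj₂ (proj₂ (O.log x x≢0)))) (sym (+-identityˡ _)))) (X-+ω^ 0# b)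

    σ-X+ω^ : ∀ x b → σ (X (x + pow ω b)) ≡ σ (X x) ⊕ scale (pow ω′ b) (s ω′ c₀)
    σ-X+ω^ x b = begin
      σ (X (x + pow ω b))                                ≡⟨ cong σ (X-+ω^ x b) ⟩
      σ (X x ⊕ s ω (toℕ (index-of b)))                   ≡⟨ σ-⊕ (X x) (index-of b) ⟩
      σ (X x) ⊕ s ω′ (c (X x) ℕ.+ toℕ (index-of b))      ≡⟨ cong (σ (X x) ⊕_) (c-X x (toℕ (index-of b))) ⟩
      σ (X x) ⊕ s ω′ (c₀ ℕ.+ toℕ (index-of b))           ≡⟨ cong (λ k → σ (X x) ⊕ s ω′ (c₀ ℕ.+ k)) (Fin.toℕ-fromℕ< (m%n<n (d ℕ.* b) n)) ⟩
      σ (X x) ⊕ s ω′ (c₀ ℕ.+ (d ℕ.* b) % n)              ≡⟨ cong (σ (X x) ⊕_) (s-% ω′ O′.ω^N≡1 c₀ (d ℕ.* b)) ⟩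
      σ (X x) ⊕ s ω′ (c₀ ℕ.+ d ℕ.* b)                    ≡⟨ cong (σ (X x) ⊕_) (s-+d* ω′ c₀ b) ⟩
      σ (X x) ⊕ scale (pow ω′ b) (s ω′ c₀)               ∎

    i₀ : Fin d
    i₀ = proj₁ (s-nonzero ω′ O′.ω≢0 c₀)

    w : F
    w = lookup (s ω′ c₀) i₀

    g : F → F
    g x = lookup (σ (X x)) i₀ - lookup (σ (X 0#)) i₀

    g-+ω^ : ∀ x b → g (x + pow ω b) ≡ g x + pow ω′ b * w
    g-+ω^ x b = begin
      lookup (σ (X (x + pow ω b))) i₀ - e                               ≡⟨ cong (λ v → lookup v i₀ - e) (σ-X+ω^ x b) ⟩
      lookup (σ (X x) ⊕ scale (pow ω′ b) (s ω′ c₀)) i₀ - e              ≡⟨ cong (_- e) (lookup-⊕ (σ (X x)) _ i₀) ⟩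
      (lookup (σ (X x)) i₀ + lookup (scale (pow ω′ b) (s ω′ c₀)) i₀) - e ≡⟨ cong (λ y → (lookup (σ (X x)) i₀ + y) - e) (lookup-scale (pow ω′ b) (s ω′ c₀) i₀) ⟩
      (lookup (σ (X x)) i₀ + pow ω′ b * w) - e                          ≡⟨ +-xy∙z≈xz∙y (lookup (σ (X x)) i₀) (pow ω′ b * w) (- e) ⟩
      g x + pow ω′ b * w                                                ∎
      where e = lookup (σ (X 0#)) i₀

    g-0# : g 0# ≡ 0#
    g-0# = -‿inverseʳ _

    g-ω^ : ∀ b → g (pow ω b) ≡ pow ω′ b * w
    g-ω^ b = begin
      g (pow ω b)                ≡⟨ cong g (+-identityˡ (pow ω b)) ⟨
      g (0# + pow ω b)           ≡⟨ g-+ω^ 0# b ⟩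
      g 0# + pow ω′ b * w        ≡⟨ cong (_+ pow ω′ b * w) g-0# ⟩
      0# + pow ω′ b * w          ≡⟨ +-identityˡ _ ⟩
      pow ω′ b * w               ∎

    g-+ : ∀ x y → g (x + y) ≡ g x + g y
    g-+ x y with y ≟ 0#
    ... | yes y≡0 = begin
      g (x + y)     ≡⟨ cong (λ z → g (x + z)) y≡0 ⟩
      g (x + 0#)    ≡⟨ cong g (+-identityʳ x) ⟩
      g x           ≡⟨ +-identityʳ (g x) ⟨
      g x + 0#      ≡⟨ cong (g x +_) (trans (cong g y≡0) g-0#) ⟨
      g x + g y     ∎
    ... | no y≢0 = begin
      g (x + y)              ≡⟨ cong (λ z → g (x + z)) ωᵇ≡y ⟨
      g (x + pow ω b)        ≡⟨ g-+ω^ x b ⟩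
      g x + pow ω′ b * w     ≡⟨ cong (g x +_) (g-ω^ b) ⟨
      g x + g (pow ω b)      ≡⟨ cong (λ z → g x + g z) ωᵇ≡y ⟩
      g x + g y              ∎
      where
      b = proj₁ (O.log y y≢0)
      ωᵇ≡y = proj₂ (proj₂ (O.log y y≢0))

    g-monomial : ∀ t → pow ω (suc t) ≡ ω′ → ∀ x → g x ≡ w * pow x (suc t)
    g-monomial t ω¹⁺ᵗ≡ω′ x with x ≟ 0#
    ... | yes x≡0 = trans (cong g x≡0) (trans g-0# (sym (trans (cong (λ y → w * pow y (suc t)) x≡0) (trans (cong (w *_) (zeroˡ _)) (zeroʳ w)))))
    ... | no x≢0  = begin
      g x                               ≡⟨ cong g ωᵇ≡x ⟨
      g (pow ω b)                       ≡⟨ g-ω^ b ⟩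
      pow ω′ b * w                      ≡⟨ cong (λ y → pow y b * w) ω¹⁺ᵗ≡ω′ ⟨
      pow (pow ω (suc t)) b * w         ≡⟨ cong (_* w) (pow-comm ω (suc t) b) ⟩
      pow (pow ω b) (suc t) * w         ≡⟨ *-comm _ w ⟩
      w * pow (pow ω b) (suc t)         ≡⟨ cong (λ y → w * pow y (suc t)) ωᵇ≡x ⟩
      w * pow x (suc t)                 ∎
      where
      b = proj₁ (O.log x x≢0)
      ωᵇ≡x = proj₂ (proj₂ (O.log x x≢0))

    iso⇒additive : ∀ t → pow ω (suc t) ≡ ω′ → Additive (suc t)
    iso⇒additive t ω¹⁺ᵗ≡ω′ x y = *-cancelˡ w (proj₂ (s-nonzero ω′ O′.ω≢0 c₀)) (begin
      w * pow (x + y) (suc t)                     ≡⟨ g-monomial t ω¹⁺ᵗ≡ω′ (x + y) ⟨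
      g (x + y)                                   ≡⟨ g-+ x y ⟩
      g x + g y                                   ≡⟨ cong₂ _+_ (g-monomial t ω¹⁺ᵗ≡ω′ x) (g-monomial t ω¹⁺ᵗ≡ω′ y) ⟩
      w * pow x (suc t) + w * pow y (suc t)       ≡⟨ distribˡ w _ _ ⟨
      w * (pow x (suc t) + pow y (suc t))         ∎)

    iso⇒frobenius-conjugate : ∀ {p} → Prime p → p ⊠ 1# ≡ 0# → ∃ λ k → ω′ ≡ pow ω (p ^ k)
    iso⇒frobenius-conjugate {p} p-prime p⊠1#≡0# = conjugate (O.log ω′ O′.ω≢0)
      where
      conjugate : (∃ λ t → t < N × pow ω t ≡ ω′) → ∃ λ k → ω′ ≡ pow ω (p ^ k)
      conjugate (zero , _ , 1≡ω′) = 0 , (begin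
        ω′        ≡⟨ 1≡ω′ ⟨
        1#        ≡⟨ O.ω^N≡1 ⟨
        pow ω N   ≡⟨ cong (pow ω) N≡1 ⟩
        pow ω 1   ∎)
        where
        N≡1 : N ≡ 1
        N≡1 = ℕ.≤-antisym (O′.period⇒N≤ 1 (s≤s z≤n) (trans (*-identityʳ ω′) (sym 1≡ω′))) (s≤s z≤n)
      conjugate (suc t , 1+t<N , ω¹⁺ᵗ≡ω′) =
        let a , 1+t≡pᵃ = additive⇒p-power p-prime p⊠1#≡0# ω-gen (suc t) 1+t<N (iso⇒additive t ω¹⁺ᵗ≡ω′)
        in a , trans (sym ω¹⁺ᵗ≡ω′) (cong (pow ω) 1+t≡pᵃ)

module FrobeniusIsomorphism {r : ℕ} (𝔽 : FiniteField (suc (suc r))) (d′ : ℕ)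
                            {p e} (p-prime : Prime p) (1≤e : 1 ≤ e) (q≡pᵉ : suc (suc r) ≡ p ^ e) where
  open FieldProperties 𝔽
  open CharacteristicPrime p-prime (p⊠1#≡0# {p} {e} q≡pᵉ)
  open MultiplicativeGroup 𝔽
  open ≡-Reasoning

  -- x ↦ x^(p^(k(e-1))) inverts x ↦ x^(p^k), since x^(q^k) = x
  frobenius^-iso : ∀ {ω} → IsGenerator ω → ∀ k → HammingIsomorphic 𝔽 (suc d′) ω (pow ω (p ^ k))
  frobenius^-iso ω-gen k = Automorphism.automorphism⇒iso 𝔽 d′
    (λ x → pow x (p ^ k)) (λ x → pow x (p ^ l)) inverse₁ inverse₂
    (frobenius^-+ k) (λ x y → pow-distrib-* x y (p ^ k)) (pow-1# (p ^ k)) _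
    where
    l = k ℕ.* (e ∸ 1)
    pᵏpˡ≡qᵏ : p ^ k ℕ.* p ^ l ≡ suc (suc r) ^ k
    pᵏpˡ≡qᵏ = begin
      p ^ k ℕ.* p ^ l          ≡⟨ ℕ.^-distribˡ-+-* p k l ⟨
      p ^ (k ℕ.+ l)            ≡⟨ cong (p ^_) (ℕ.*-suc k (e ∸ 1)) ⟨
      p ^ (k ℕ.* suc (e ∸ 1))  ≡⟨ cong (λ e′ → p ^ (k ℕ.* e′)) (ℕ.m+[n∸m]≡n 1≤e) ⟩
      p ^ (k ℕ.* e)            ≡⟨ cong (p ^_) (ℕ.*-comm k e) ⟩
      p ^ (e ℕ.* k)            ≡⟨ ℕ.^-*-assoc p e k ⟨
      (p ^ e) ^ k              ≡⟨ cong (_^ k) q≡pᵉ ⟨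
      suc (suc r) ^ k          ∎
    x^qᵏ≡x : ∀ j x → pow x (suc (suc r) ^ j) ≡ x
    x^qᵏ≡x zero    x = *-identityʳ x
    x^qᵏ≡x (suc j) x = begin
      pow x (suc (suc r) ℕ.* suc (suc r) ^ j)  ≡⟨ pow-* x (suc (suc r)) (suc (suc r) ^ j) ⟩
      pow (pow x (suc (suc r))) (suc (suc r) ^ j) ≡⟨ cong (λ y → pow y (suc (suc r) ^ j)) (Order.fermat ω-gen x) ⟩
      pow x (suc (suc r) ^ j)                  ≡⟨ x^qᵏ≡x j x ⟩
      x                                        ∎
    inverse₁ : ∀ x → pow (pow x (p ^ k)) (p ^ l) ≡ x
    inverse₁ x = trans (sym (pow-* x (p ^ k) (p ^ l))) (trans (cong (pow x) pᵏpˡ≡qᵏ) (x^qᵏ≡x k x))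
    inverse₂ : ∀ x → pow (pow x (p ^ l)) (p ^ k) ≡ x
    inverse₂ x = trans (pow-comm x (p ^ l) (p ^ k)) (inverse₁ x)

theorem2p2 : (p e q : ℕ) → Prime p → 1 ≤ e → q ≡ p ^ e →
    (𝔽 : FiniteField q) → (d : ℕ) → 1 ≤ d →
    (ω ω' : FiniteField.F 𝔽) →
    FiniteField.IsGenerator 𝔽 ω → FiniteField.IsGenerator 𝔽 ω' →
    (HammingIsomorphic 𝔽 d ω ω' ⇔ ∃ λ k → ω' ≡ FiniteField.pow 𝔽 ω (p ^ k))
theorem2p2 p e zero          _       _   _    𝔽 _        _ _ _  _    _     = contradiction (FieldProperties.2≤q 𝔽) λ ()
theorem2p2 p e (suc zero)    _       _   _    𝔽 _        _ _ _  _    _     = contradiction (FieldProperties.2≤q 𝔽) λ { (s≤s ()) }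
theorem2p2 p e (suc (suc r)) p-prime 1≤e q≡pᵉ 𝔽 (suc d′) _ ω ω′ ω-gen ω′-gen = mk⇔
  (λ iso → IsomorphismInvariants.iso⇒frobenius-conjugate 𝔽 d′ ω-gen ω′-gen iso p-prime
             (FieldProperties.p⊠1#≡0# 𝔽 {p} {e} q≡pᵉ))
  (λ (k , ω′≡ωᵖᵏ) → subst (HammingIsomorphic 𝔽 (suc d′) ω) (sym ω′≡ωᵖᵏ)
                      (FrobeniusIsomorphism.frobenius^-iso 𝔽 d′ p-prime 1≤e q≡pᵉ ω-gen k))
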